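{- Let $t\ge 2$ be an integer and let $P_t$ be the path graph on $t$ vertices. If $\Gamma$ is a finite simple graph with $A(\Gamma;x)=A(P_t;x)$, then $\Gamma$ is isomorphic to $P_t$.
   Context: All graphs are finite and simple with at least one vertex. For a graph $\Gamma=(V,E)$ of order $n$, a vertex $v$ and $X\subseteq V$, let $\delta_X(v)$ be the number of neighbours of $v$ in $X$, $\delta(v)=\delta_V(v)$, $\delta_1$ the maximum degree, and $\bar S=V\setminus S$. Let $\mathcal{K}=[-\delta_1,\delta_1]\cap\mathbb{Z}$. A nonempty $S\subseteq V$ is a defensive $k$-alliance if $\delta_S(v)\ge\delta_{\bar S}(v)+k$ for all $v\in S$. The exact index of alliance of a nonempty $S$ is $k_S=\max\{k\in\mathcal{K}: S \text{ is a defensive } k\text{ -alliance}\}$ (equivalently $k_S=\min_{v\in S}(\delta_S(v)-\delta_{\bar S}(v))$). The alliance polynomial is $A(\Gamma;x)=\sum_{S} x^{n+k_S}$, the sum over all nonempty $S\subseteq V$ whose induced subgraph $\langle S\rangle$ is connected. -}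

module Defs where

open import Data.Bool using (Bool; true; false; _∧_; _∨_; not; if_then_else_; T)
open import Data.Nat using (ℕ; zero; suc; _≤_; _≡ᵇ_)
import Data.Nat as ℕ
open import Data.Integer as ℤ using (ℤ; +_; _-_; _⊓_; _⊔_)
open import Data.Fin using (Fin; toℕ)
open import Data.Fin.Subset using (Subset; _∈_)
open import Data.Vec using (Vec; []; _∷_; lookup)
open import Data.List using (List; []; _∷_; map; length; filterᵇ; foldr; _++_)
open import Data.List.Base using (allFin)
open import Relation.Nullary.Decidable using (⌊_⌋)
open import Relation.Binary.PropositionalEquality using (_≡_)
open import Function.Bundles using (_↔_; Inverse)

record Graph : Set where
  field
    order    : ℕ
    nonempty : 1 ≤ order
    adj      : Fin order → Fin order → Bool
    sym      : ∀ u v → adj u v ≡ adj v u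
    irrefl   : ∀ v → adj v v ≡ false
open Graph public

allSubsets : (n : ℕ) → List (Subset n)
allSubsets zero    = [] ∷ []
allSubsets (suc n) = map (true ∷_) (allSubsets n) ++ map (false ∷_) (allSubsets n)

module _ (Γ : Graph) where
  private
    n = order Γ
    V = allFin n

  count : (Fin n → Bool) → ℕ
  count p = length (filterᵇ p V)

  δ_ : Subset n → Fin n → ℕ
  δ_ X v = count (λ u → adj Γ v u ∧ lookup X u)

  deg : Fin n → ℕ
  deg v = count (λ u → adj Γ v u)

  maxDeg : ℕ
  maxDeg = foldr ℕ._⊔_ 0 (map deg V)

  complement : Subset n → Subset n
  complement = Data.Vec.map not

  isNonempty : Subset n → Bool
  isNonempty S = foldr _∨_ false (map (lookup S) V)

  subsetᵇ : Subset n → Subset n → Bool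
  subsetᵇ S T = foldr _∧_ true (map (λ v → not (lookup S v) ∨ lookup T v) V)

  eqSetᵇ : Subset n → Subset n → Bool
  eqSetᵇ S T = subsetᵇ S T ∧ subsetᵇ T S

  edgeBetween : Subset n → Subset n → Bool
  edgeBetween A B =
    foldr _∨_ false (map (λ u → foldr _∨_ false
      (map (λ v → lookup A u ∧ lookup B v ∧ adj Γ u v) V)) V)

  connectedᵇ : Subset n → Bool
  connectedᵇ S = isNonempty S ∧
    foldr _∧_ true (map (λ T →
      not (subsetᵇ T S ∧ isNonempty T ∧ not (eqSetᵇ T S))
      ∨ edgeBetween T (Data.Vec.zipWith _∧_ S (complement T))) (allSubsets n))

  -- exact index of alliance:
  -- k_S = max{k ∈ [-δ₁,δ₁] : ∀ v ∈ S, δ_S(v) ≥ δ_{S̄}(v) + k}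
  --     = min(δ₁, min_{v ∈ S} (δ_S(v) - δ_{S̄}(v)))  (= min_{v∈S}(…) for S ≠ ∅)
  kIndex : Subset n → ℤ
  kIndex S = foldr _⊓_ (+ maxDeg)
    (map (λ v → (+ δ_ S v) - (+ δ_ (complement S) v)) (filterᵇ (lookup S) V))

  -- coefficient of x^j in the alliance polynomial A(Γ;x) = Σ_S x^{n + k_S}
  -- (sum over nonempty S with ⟨S⟩ connected)
  allianceCoeff : ℤ → ℕ
  allianceCoeff j = length (filterᵇ
    (λ S → connectedᵇ S ∧ ⌊ (+ n) ℤ.+ kIndex S ℤ.≟ j ⌋) (allSubsets n))

SameAlliancePoly : Graph → Graph → Set
SameAlliancePoly Γ Δ = ∀ j → allianceCoeff Γ j ≡ allianceCoeff Δ j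

record _≅_ (Γ Δ : Graph) : Set where
  field
    bij      : Fin (order Γ) ↔ Fin (order Δ)
    preserve : ∀ u v → adj Γ u v ≡ adj Δ (Inverse.to bij u) (Inverse.to bij v)

pathAdj : (t : ℕ) → Fin t → Fin t → Bool
pathAdj t i j = (suc (toℕ i) ≡ᵇ toℕ j) ∨ (suc (toℕ j) ≡ᵇ toℕ i)


private
  suc≢ᵇ : ∀ k → (suc k ≡ᵇ k) ≡ false
  suc≢ᵇ zero    = Relation.Binary.PropositionalEquality.refl
  suc≢ᵇ (suc k) = suc≢ᵇ k

open import Data.Bool.Properties using (∨-comm)

pathGraph : (t : ℕ) → 1 ≤ t → Graph
pathGraph t 1≤t = record
  { order    = t
  ; nonempty = 1≤t
  ; adj      = pathAdj t
  ; sym      = λ u v → ∨-comm (suc (toℕ u) ≡ᵇ toℕ v) (suc (toℕ v) ≡ᵇ toℕ u)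
  ; irrefl   = λ v → Relation.Binary.PropositionalEquality.cong (λ b → b ∨ b) (suc≢ᵇ (toℕ v))
  }

-- Write n for the order, δ₁ for the maximum degree, and call δ_S(v) - δ_S̄(v)
-- the surplus of v ∈ S, so that k_S is the least surplus over S.  Since
-- k_S ≥ -δ₁, with equality for {v} when δ(v) = δ₁, the lowest exponent of
-- A(Γ; x) is n - δ₁; a vertex with a neighbour in S has surplus ≥ 2 - δ₁,
-- so the coefficients of x^(n-δ₁) and x^(n-δ₁+1) count the vertices of
-- degree δ₁ and δ₁ - 1 (LowCoefficients).  As P_t has degrees 1 and 2, this
-- gives t ≤ n.  Connected sets of P_t have k ≤ 1, so all exponents are at
-- most t + 1, while the component of a vertex of maximum degree in Γ has
-- index ≥ 1 (Components); hence n = t, and Γ inherits the degrees of P_t,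
-- its number of leaves, and k_S ≤ 1 for all connected S (LikeAPath).  Such a
-- graph is a path (Recognition): the walk from a leaf is an induced path
-- ending at another leaf, and it covers Γ because a component of degree-2
-- vertices would have index 2.
module Submission where

open import Defs hiding (sym)
open import Data.Bool using (Bool; true; false; _∧_; _∨_; not; T) renaming (_≟_ to _≟ᵇ_)
open import Data.Bool.ListAction using (all; any)
open import Data.Bool.Properties using (T-≡; ¬-not; ∧-zeroʳ; ∨-zeroʳ; ∨-identityʳ)
open import Data.Empty using (⊥; ⊥-elim)
open import Data.Fin using (Fin; toℕ; fromℕ<) renaming (_≟_ to _≟ᶠ_)
import Data.Fin as Fin
open import Data.Fin.Properties using (any?; toℕ-fromℕ<; toℕ-injective; toℕ<n; injective⇒≤)
open import Data.Integer as ℤ using (ℤ; +_; -_; _⊓_; +≤+)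
import Data.Integer.Properties as ℤ
open import Data.Integer.Tactic.RingSolver using (solve-∀)
open import Data.List using (List; []; _∷_; map; length; foldr; filterᵇ; allFin)
open import Data.List.Properties using (length-map; length-tabulate; length-filter; filter-none)
open import Data.List.Membership.Propositional using (_∈_; find; lose)
open import Data.List.Membership.Propositional.Properties using (∈-filter⁺; ∈-filter⁻; ∈-allFin; ∈-map⁺; ∈-map⁻; ∈-++⁺ˡ; ∈-++⁺ʳ)
open import Data.List.Relation.Unary.All using (All; []; _∷_)
import Data.List.Relation.Unary.All as All
open import Data.List.Relation.Unary.All.Properties using (All¬⇒¬Any; all⁺; all⁻)
open import Data.List.Relation.Unary.AllPairs using ([]; _∷_)
open import Data.List.Relation.Unary.Any using (here; there)
open import Data.List.Relation.Unary.Any.Properties using (any⁺; any⁻)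
open import Data.List.Relation.Unary.Unique.Propositional using (Unique)
open import Data.List.Relation.Unary.Unique.Propositional.Properties using (allFin⁺; filter⁺)
import Data.List.Relation.Unary.Unique.Propositional.Properties as Unique
open import Data.Nat using (ℕ; zero; suc; _+_; _∸_; _≤_; _<_; _⊔_; _≡ᵇ_; z≤n; s≤s)
open import Data.Nat.Properties using (≤-trans; n≤1+n)
import Data.Nat.Properties as ℕ
open import Data.Product using (∃; ∃₂; _×_; _,_; proj₁; proj₂)
open import Data.Sum using (_⊎_; inj₁; inj₂; map₂)
open import Data.Vec using (Vec; []; _∷_; lookup; tabulate; zipWith)
open import Data.Vec.Properties using (lookup-map; lookup-zipWith; lookup∘tabulate; tabulate∘lookup; tabulate-cong)
open import Function using (_∘_)
open import Function.Bundles using (Equivalence; mk↔ₛ′)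
open import Relation.Binary.Definitions using (tri<; tri≈; tri>)
open import Relation.Binary.PropositionalEquality using (_≡_; _≢_; refl; sym; trans; cong; cong₂; subst; subst₂; module ≡-Reasoning)
open import Relation.Nullary using (Dec; yes; no; ¬_)
open import Relation.Nullary.Decidable using (⌊_⌋; T?; ¬?; _×-dec_)

true≢false : true ≢ false
true≢false ()

∧-elim : ∀ {a b} → a ∧ b ≡ true → a ≡ true × b ≡ true
∧-elim {true} {true} _ = refl , refl

∨-elim : ∀ {a b} → a ∨ b ≡ true → a ≡ true ⊎ b ≡ true
∨-elim {true} _ = inj₁ refl
∨-elim {false} e = inj₂ e

∧-not-elim : ∀ {a b} → a ∧ not b ≡ true → a ≡ true × b ≡ false
∧-not-elim {true} {false} _ = refl , refl

⌊⌋-true : {P : Set} (d : Dec P) → P → ⌊ d ⌋ ≡ true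
⌊⌋-true (yes _) _ = refl
⌊⌋-true (no ¬p) p = ⊥-elim (¬p p)

⌊⌋-false : {P : Set} (d : Dec P) → ¬ P → ⌊ d ⌋ ≡ false
⌊⌋-false (yes p) ¬p = ⊥-elim (¬p p)
⌊⌋-false (no _) _ = refl

⌊⌋-sound : {P : Set} (d : Dec P) → ⌊ d ⌋ ≡ true → P
⌊⌋-sound (yes p) _ = p

≡ᵇ-true : ∀ {m k} → m ≡ k → (m ≡ᵇ k) ≡ true
≡ᵇ-true {m} {k} e = Equivalence.to T-≡ (ℕ.≡⇒≡ᵇ m k e)

≡ᵇ-sound : ∀ {m k} → (m ≡ᵇ k) ≡ true → m ≡ k
≡ᵇ-sound {m} {k} e = ℕ.≡ᵇ⇒≡ m k (Equivalence.from T-≡ e)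

≡ᵇ-false : ∀ {m k} → m ≢ k → (m ≡ᵇ k) ≡ false
≡ᵇ-false {m} {k} m≢k with m ≡ᵇ k in e
... | true = ⊥-elim (m≢k (≡ᵇ-sound e))
... | false = refl

≡ᵇ-cancelˡ : ∀ c a b → (c + a ≡ᵇ c + b) ≡ (a ≡ᵇ b)
≡ᵇ-cancelˡ zero a b = refl
≡ᵇ-cancelˡ (suc c) a b = ≡ᵇ-cancelˡ c a b

delete-member : {A : Set} {x : A} {ys : List A} → x ∈ ys →
  ∃ λ ys′ → length ys ≡ suc (length ys′) × (∀ {z} → z ∈ ys → z ≡ x ⊎ z ∈ ys′)
delete-member {ys = _ ∷ ys} (here refl) = ys , refl , λ { (here refl) → inj₁ refl ; (there m) → inj₂ m }
delete-member {ys = y ∷ _} (there m) with delete-member m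
... | ys′ , len , split = y ∷ ys′ , cong suc len , λ { (here refl) → inj₂ (here refl) ; (there m′) → map₂ there (split m′) }

unique-length : {A : Set} {xs ys : List A} → Unique xs → (∀ {x} → x ∈ xs → x ∈ ys) → length xs ≤ length ys
unique-length {xs = []} _ _ = z≤n
unique-length {xs = x ∷ xs} (x∉xs ∷ u) xs⊆ys with delete-member (xs⊆ys (here refl))
... | ys′ , len , split = subst (suc (length xs) ≤_) (sym len) (s≤s (unique-length u xs⊆ys′))
  where
  xs⊆ys′ : ∀ {z} → z ∈ xs → z ∈ ys′
  xs⊆ys′ m with split (xs⊆ys (there m))
  ... | inj₁ refl = ⊥-elim (All¬⇒¬Any x∉xs m)
  ... | inj₂ m′ = m′

∈-filterᵇ⁺ : {A : Set} (p : A → Bool) {x : A} {xs : List A} → x ∈ xs → p x ≡ true → x ∈ filterᵇ p xs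
∈-filterᵇ⁺ p m px = ∈-filter⁺ (T? ∘ p) m (Equivalence.from T-≡ px)

∈-filterᵇ⁻ : {A : Set} (p : A → Bool) {x : A} {xs : List A} → x ∈ filterᵇ p xs → x ∈ xs × p x ≡ true
∈-filterᵇ⁻ p {xs = xs} m = let (m′ , px) = ∈-filter⁻ (T? ∘ p) {xs = xs} m in m′ , Equivalence.to T-≡ px

-- Counting the vertices of Fin n satisfying a Boolean predicate; this is
-- definitionally the function count of Defs.
module Counting {n : ℕ} where

  cnt : (Fin n → Bool) → ℕ
  cnt p = length (filterᵇ p (allFin n))

  sat⁺ : (p : Fin n → Bool) {v : Fin n} → p v ≡ true → v ∈ filterᵇ p (allFin n)
  sat⁺ p {v} = ∈-filterᵇ⁺ p (∈-allFin v)

  sat⁻ : (p : Fin n → Bool) {v : Fin n} → v ∈ filterᵇ p (allFin n) → p v ≡ true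
  sat⁻ p m = proj₂ (∈-filterᵇ⁻ p {xs = allFin n} m)

  distinct≤cnt : (p : Fin n → Bool) {xs : List (Fin n)} → Unique xs → (∀ {x} → x ∈ xs → p x ≡ true) → length xs ≤ cnt p
  distinct≤cnt p u sat = unique-length u (λ m → sat⁺ p (sat m))

  cnt-mono : (p q : Fin n → Bool) → (∀ v → p v ≡ true → q v ≡ true) → cnt p ≤ cnt q
  cnt-mono p q p⇒q = distinct≤cnt q (filter⁺ (T? ∘ p) (allFin⁺ n)) (λ m → p⇒q _ (sat⁻ p m))

  cnt-ext : (p q : Fin n → Bool) → (∀ v → p v ≡ q v) → cnt p ≡ cnt q
  cnt-ext p q p≗q = ℕ.≤-antisym (cnt-mono p q (λ v e → trans (sym (p≗q v)) e)) (cnt-mono q p (λ v e → trans (p≗q v) e))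

  cnt≤n : (p : Fin n → Bool) → cnt p ≤ n
  cnt≤n p = ℕ.≤-trans (length-filter (T? ∘ p) (allFin n)) (ℕ.≤-reflexive (length-tabulate _))

  cnt-all : cnt (λ _ → true) ≡ n
  cnt-all = ℕ.≤-antisym (cnt≤n _) (ℕ.≤-trans (ℕ.≤-reflexive (sym (length-tabulate _))) (distinct≤cnt _ (allFin⁺ n) (λ _ → refl)))

  cnt-none : (p : Fin n → Bool) → (∀ v → p v ≡ false) → cnt p ≡ 0
  cnt-none p none = cong length (filter-none (T? ∘ p) {xs = allFin n} (All.tabulate (λ {v} _ → subst T (none v))))

  cnt-split : (p q : Fin n → Bool) → cnt p ≡ cnt (λ v → p v ∧ q v) + cnt (λ v → p v ∧ not (q v))
  cnt-split p q = go (allFin n)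
    where
    go : (xs : List (Fin n)) → length (filterᵇ p xs) ≡ length (filterᵇ (λ v → p v ∧ q v) xs) + length (filterᵇ (λ v → p v ∧ not (q v)) xs)
    go [] = refl
    go (x ∷ xs) with p x | q x
    ... | true  | true  = cong suc (go xs)
    ... | true  | false = trans (cong suc (go xs)) (sym (ℕ.+-suc _ _))
    ... | false | _     = go xs

  cnt-pos : (p : Fin n → Bool) {v : Fin n} → p v ≡ true → 1 ≤ cnt p
  cnt-pos p pv = distinct≤cnt p ([] ∷ []) λ { (here refl) → pv }

  cnt-strict : (p q : Fin n → Bool) → (∀ v → p v ≡ true → q v ≡ true) → {u : Fin n} → q u ≡ true → p u ≡ false → suc (cnt p) ≤ cnt q
  cnt-strict p q p⇒q {u} qu pu = begin
    suc (cnt p)                                              ≡⟨ ℕ.+-comm 1 (cnt p) ⟩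
    cnt p + 1                                                ≤⟨ ℕ.+-mono-≤ (cnt-mono p _ inside) (cnt-pos _ {u} outside) ⟩
    cnt (λ v → q v ∧ p v) + cnt (λ v → q v ∧ not (p v))      ≡⟨ sym (cnt-split q p) ⟩
    cnt q                                                    ∎
    where
    inside : ∀ v → p v ≡ true → q v ∧ p v ≡ true
    inside v pv rewrite p⇒q v pv | pv = refl
    outside : q u ∧ not (p u) ≡ true
    outside rewrite qu | pu = refl
    open ℕ.≤-Reasoning

  cnt-witness : (p : Fin n → Bool) → 1 ≤ cnt p → ∃ λ v → p v ≡ true
  cnt-witness p pos with filterᵇ p (allFin n) in e
  ... | v ∷ _ = v , sat⁻ p (subst (v ∈_) (sym e) (here refl))

  two≤cnt : (p : Fin n → Bool) {x y : Fin n} → x ≢ y → p x ≡ true → p y ≡ true → 2 ≤ cnt p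
  two≤cnt p x≢y px py = distinct≤cnt p ((x≢y ∷ []) ∷ [] ∷ []) λ { (here refl) → px ; (there (here refl)) → py }

  three≤cnt : (p : Fin n → Bool) {x y z : Fin n} → x ≢ y → x ≢ z → y ≢ z → p x ≡ true → p y ≡ true → p z ≡ true → 3 ≤ cnt p
  three≤cnt p x≢y x≢z y≢z px py pz = distinct≤cnt p ((x≢y ∷ x≢z ∷ []) ∷ (y≢z ∷ []) ∷ [] ∷ [])
    λ { (here refl) → px ; (there (here refl)) → py ; (there (there (here refl))) → pz }

  at-most-one : (p : Fin n → Bool) → cnt p ≤ 1 → {x y : Fin n} → p x ≡ true → p y ≡ true → x ≡ y
  at-most-one p le {x} {y} px py with x ≟ᶠ y
  ... | yes x≡y = x≡y
  ... | no x≢y with ℕ.≤-trans (two≤cnt p x≢y px py) le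
  ...   | s≤s ()

  at-most-two : (p : Fin n → Bool) → cnt p ≤ 2 → {x y z : Fin n} → x ≢ y → p x ≡ true → p y ≡ true → p z ≡ true → z ≡ x ⊎ z ≡ y
  at-most-two p le {x} {y} {z} x≢y px py pz with z ≟ᶠ x | z ≟ᶠ y
  ... | yes z≡x | _ = inj₁ z≡x
  ... | no _ | yes z≡y = inj₂ z≡y
  ... | no z≢x | no z≢y with ℕ.≤-trans (three≤cnt p x≢y (z≢x ∘ sym) (z≢y ∘ sym) px py pz) le
  ...   | s≤s (s≤s ())

  cnt≤1 : (p : Fin n → Bool) → (∀ {x y} → p x ≡ true → p y ≡ true → x ≡ y) → cnt p ≤ 1
  cnt≤1 p same with filterᵇ p (allFin n) in e | filter⁺ (T? ∘ p) (allFin⁺ n)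
  ... | [] | _ = z≤n
  ... | _ ∷ [] | _ = s≤s z≤n
  ... | x ∷ y ∷ _ | (x≢y ∷ _) ∷ _ = ⊥-elim (x≢y (same (member (here refl)) (member (there (here refl)))))
    where
    member : ∀ {v} → v ∈ x ∷ y ∷ _ → p v ≡ true
    member m = sat⁻ p (subst (_ ∈_) (sym e) m)

  another : (p : Fin n → Bool) → 2 ≤ cnt p → (u : Fin n) → ∃ λ v → p v ≡ true × v ≢ u
  another p two u with any? (λ v → (p v ≟ᵇ true) ×-dec ¬? (v ≟ᶠ u))
  ... | yes found = found
  ... | no none = ⊥-elim (ℕ.<-irrefl refl (ℕ.≤-trans two (cnt≤1 p λ px py → trans (is-u px) (sym (is-u py)))))
    where
    is-u : ∀ {v} → p v ≡ true → v ≡ u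
    is-u {v} pv with v ≟ᶠ u
    ... | yes v≡u = v≡u
    ... | no v≢u = ⊥-elim (none (v , pv , v≢u))

  cnt-or : (p q : Fin n → Bool) → cnt (λ v → p v ∨ q v) ≤ cnt p + cnt q
  cnt-or p q = ℕ.≤-trans (ℕ.≤-reflexive (cnt-split (λ v → p v ∨ q v) p))
    (ℕ.+-mono-≤ (cnt-mono _ p (λ v → left (p v) (q v))) (cnt-mono _ q (λ v → right (p v) (q v))))
    where
    left : ∀ a b → (a ∨ b) ∧ a ≡ true → a ≡ true
    left true _ _ = refl
    left false true ()
    left false false ()
    right : ∀ a b → (a ∨ b) ∧ not a ≡ true → b ≡ true
    right false true _ = refl

  cnt-disjoint : (p q : Fin n → Bool) → (∀ v → p v ≡ true → q v ≡ false) → cnt (λ v → p v ∨ q v) ≡ cnt p + cnt q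
  cnt-disjoint p q disj = trans (cnt-split (λ v → p v ∨ q v) p)
    (cong₂ _+_ (cnt-ext _ p (λ v → left (p v) (q v))) (cnt-ext _ q (λ v → right (p v) (q v) (disj v))))
    where
    left : ∀ a b → (a ∨ b) ∧ a ≡ a
    left true _ = refl
    left false true = refl
    left false false = refl
    right : ∀ a b → (a ≡ true → b ≡ false) → (a ∨ b) ∧ not a ≡ b
    right true _ d = sym (d refl)
    right false true _ = refl
    right false false _ = refl

  cnt-cover : (p q : Fin n → Bool) → (∀ v → p v ≡ true → q v ≡ false) → n ≤ cnt p + cnt q → ∀ v → p v ∨ q v ≡ true
  cnt-cover p q disj full v with p v ∨ q v in missed
  ... | true = refl
  ... | false = ⊥-elim (ℕ.<-irrefl refl (begin-strict
        n                                                   ≤⟨ full ⟩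
        cnt p + cnt q                                       ≡⟨ sym (cnt-disjoint p q disj) ⟩
        cnt (λ u → p u ∨ q u)                               <⟨ ℕ.m<m+n _ (cnt-pos (λ u → not (p u ∨ q u)) (cong not missed)) ⟩
        cnt (λ u → p u ∨ q u) + cnt (λ u → not (p u ∨ q u))  ≡⟨ sym (cnt-split (λ _ → true) (λ u → p u ∨ q u)) ⟩
        cnt (λ _ → true)                                    ≡⟨ cnt-all ⟩
        n                                                   ∎))
    where open ℕ.≤-Reasoning

module BoolFolds {A : Set} where

  all-elim : (f : A → Bool) {xs : List A} → all f xs ≡ true → ∀ {x} → x ∈ xs → f x ≡ true
  all-elim f {xs} h m = Equivalence.to T-≡ (All.lookup (all⁺ f xs (Equivalence.from T-≡ h)) m)

  all-intro : (f : A → Bool) (xs : List A) → (∀ {x} → x ∈ xs → f x ≡ true) → all f xs ≡ true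
  all-intro f xs h = Equivalence.to T-≡ (all⁻ f (All.tabulate (Equivalence.from T-≡ ∘ h)))

  any-elim : (f : A → Bool) (xs : List A) → any f xs ≡ true → ∃ λ x → x ∈ xs × f x ≡ true
  any-elim f xs h with find (any⁻ f xs (Equivalence.from T-≡ h))
  ... | x , m , fx = x , m , Equivalence.to T-≡ fx

  any-intro : (f : A → Bool) {xs : List A} {x : A} → x ∈ xs → f x ≡ true → any f xs ≡ true
  any-intro f m fx = Equivalence.to T-≡ (any⁺ f (lose m (Equivalence.from T-≡ fx)))

allSubsets-complete : ∀ {n} (S : Vec Bool n) → S ∈ allSubsets n
allSubsets-complete [] = here refl
allSubsets-complete {suc n} (true ∷ S) = ∈-++⁺ˡ (∈-map⁺ (true ∷_) (allSubsets-complete S))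
allSubsets-complete {suc n} (false ∷ S) = ∈-++⁺ʳ (map (true ∷_) (allSubsets n)) (∈-map⁺ (false ∷_) (allSubsets-complete S))

allSubsets-unique : ∀ n → Unique (allSubsets n)
allSubsets-unique zero = All.[] ∷ []
allSubsets-unique (suc n) = Unique.++⁺ (Unique.map⁺ tail-injective (allSubsets-unique n))
                                       (Unique.map⁺ tail-injective (allSubsets-unique n)) heads-differ
  where
  tail-injective : ∀ {b} {S T : Vec Bool n} → b ∷ S ≡ b ∷ T → S ≡ T
  tail-injective refl = refl
  heads-differ : ∀ {S} → S ∈ map (true ∷_) (allSubsets n) × S ∈ map (false ∷_) (allSubsets n) → ⊥
  heads-differ (m₁ , m₂) with ∈-map⁻ (true ∷_) m₁ | ∈-map⁻ (false ∷_) m₂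
  ... | _ , _ , refl | _ , _ , ()

module DiffArith where

  private
    cancel-diff : ∀ (a b d : ℤ) → (a ℤ.- b) ℤ.+ (b ℤ.+ d) ≡ a ℤ.+ d
    cancel-diff = solve-∀

  diff-≤⁻ : ∀ a b c d → + a ℤ.- + b ℤ.≤ + c ℤ.- + d → a + d ≤ c + b
  diff-≤⁻ a b c d h = ℤ.drop‿+≤+ (subst₂ ℤ._≤_ (cancel-diff (+ a) (+ b) (+ d)) lhs (ℤ.+-monoˡ-≤ (+ b ℤ.+ + d) h))
    where
    lhs : (+ c ℤ.- + d) ℤ.+ (+ b ℤ.+ + d) ≡ + (c + b)
    lhs = trans (cong (λ x → (+ c ℤ.- + d) ℤ.+ x) (ℤ.+-comm (+ b) (+ d))) (cancel-diff (+ c) (+ d) (+ b))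

  diff-≤⁺ : ∀ a b c d → a + d ≤ c + b → + a ℤ.- + b ℤ.≤ + c ℤ.- + d
  diff-≤⁺ a b c d h = subst₂ ℤ._≤_ (shift (+ a) (+ d) (+ b)) (shift′ (+ c) (+ b) (+ d)) (ℤ.+-monoˡ-≤ (- + b ℤ.- + d) (+≤+ h))
    where
    shift : ∀ (x y z : ℤ) → (x ℤ.+ y) ℤ.+ (- z ℤ.- y) ≡ x ℤ.- z
    shift = solve-∀
    shift′ : ∀ (x y z : ℤ) → (x ℤ.+ y) ℤ.+ (- y ℤ.- z) ≡ x ℤ.- z
    shift′ = solve-∀

  diff-≡⁻ : ∀ a b c d → + a ℤ.- + b ≡ + c ℤ.- + d → a + d ≡ c + b
  diff-≡⁻ a b c d e = ℕ.≤-antisym (diff-≤⁻ a b c d (ℤ.≤-reflexive e)) (diff-≤⁻ c d a b (ℤ.≤-reflexive (sym e)))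

  diff-≡⁺ : ∀ a b c d → a + d ≡ c + b → + a ℤ.- + b ≡ + c ℤ.- + d
  diff-≡⁺ a b c d e = ℤ.≤-antisym (diff-≤⁺ a b c d (ℕ.≤-reflexive e)) (diff-≤⁺ c d a b (ℕ.≤-reflexive (sym e)))

  relative : ∀ n d e → + n ℤ.- + d ℤ.+ + e ≡ + n ℤ.+ (+ e ℤ.- + d)
  relative n d e = rearrange (+ n) (+ d) (+ e)
    where
    rearrange : ∀ (x y z : ℤ) → x ℤ.- y ℤ.+ z ≡ x ℤ.+ (z ℤ.- y)
    rearrange = solve-∀

  +-cancelˡ-≤ : ∀ (i j k : ℤ) → i ℤ.+ j ℤ.≤ i ℤ.+ k → j ℤ.≤ k
  +-cancelˡ-≤ i j k h = subst₂ ℤ._≤_ (unshift i j) (unshift i k) (ℤ.+-monoʳ-≤ (- i) h)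
    where
    unshift : ∀ (x y : ℤ) → - x ℤ.+ (x ℤ.+ y) ≡ y
    unshift = solve-∀

  +-cancelˡ-≡ : ∀ (i j k : ℤ) → i ℤ.+ j ≡ i ℤ.+ k → j ≡ k
  +-cancelˡ-≡ i j k e = ℤ.≤-antisym (+-cancelˡ-≤ i j k (ℤ.≤-reflexive e)) (+-cancelˡ-≤ i k j (ℤ.≤-reflexive (sym e)))

module Extrema {X : Set} where

  max-upper : (f : X → ℕ) {xs : List X} {x : X} → x ∈ xs → f x ≤ foldr _⊔_ 0 (map f xs)
  max-upper f {y ∷ _} (here refl) = ℕ.m≤m⊔n (f y) _
  max-upper f {y ∷ _} (there m) = ℕ.≤-trans (max-upper f m) (ℕ.m≤n⊔m (f y) _)

  max-attained : (f : X → ℕ) {xs : List X} {x : X} → x ∈ xs → ∃ λ y → foldr _⊔_ 0 (map f xs) ≡ f y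
  max-attained f {y ∷ []} _ = y , ℕ.⊔-identityʳ (f y)
  max-attained f {y ∷ z ∷ xs} _ with ℕ.⊔-sel (f y) (foldr _⊔_ 0 (map f (z ∷ xs))) | max-attained f {z ∷ xs} (here refl)
  ... | inj₁ e | _ = y , e
  ... | inj₂ e | w , e′ = w , trans e e′

  min-lower : (f : X → ℤ) (b : ℤ) {xs : List X} {x : X} → x ∈ xs → foldr _⊓_ b (map f xs) ℤ.≤ f x
  min-lower f b {y ∷ _} (here refl) = ℤ.i⊓j≤i (f y) _
  min-lower f b {y ∷ _} (there m) = ℤ.≤-trans (ℤ.i⊓j≤j (f y) _) (min-lower f b m)

  min-glb : (f : X → ℤ) (b c : ℤ) (xs : List X) → c ℤ.≤ b → (∀ {x} → x ∈ xs → c ℤ.≤ f x) → c ℤ.≤ foldr _⊓_ b (map f xs)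
  min-glb f b c [] c≤b _ = c≤b
  min-glb f b c (y ∷ xs) c≤b h = ℤ.⊓-glb (h (here refl)) (min-glb f b c xs c≤b (h ∘ there))

  min-attained : (f : X → ℤ) (b : ℤ) (xs : List X) → foldr _⊓_ b (map f xs) ≡ b ⊎ ∃ λ y → y ∈ xs × foldr _⊓_ b (map f xs) ≡ f y
  min-attained f b [] = inj₁ refl
  min-attained f b (y ∷ xs) with ℤ.⊓-sel (f y) (foldr _⊓_ b (map f xs)) | min-attained f b xs
  ... | inj₁ e | _ = inj₂ (y , here refl , e)
  ... | inj₂ e | inj₁ e′ = inj₁ (trans e e′)
  ... | inj₂ e | inj₂ (z , m , e′) = inj₂ (z , there m , trans e e′)

module GraphFacts (Γ : Graph) where

  open Counting
  open BoolFolds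
  open DiffArith
  open Extrema

  n : ℕ
  n = order Γ

  Sub : Set
  Sub = Vec Bool n

  A : Fin n → Fin n → Bool
  A = adj Γ

  infix 4 _∈ₛ_ _∉ₛ_
  _∈ₛ_ _∉ₛ_ : Fin n → Sub → Set
  v ∈ₛ S = lookup S v ≡ true
  v ∉ₛ S = lookup S v ≡ false

  adj-sym : ∀ {u w} → A u w ≡ true → A w u ≡ true
  adj-sym {u} {w} a = trans (Graph.sym Γ w u) a

  adj-irrefl : ∀ {u w} → A u w ≡ true → u ≢ w
  adj-irrefl {u} a refl with () ← trans (sym a) (irrefl Γ u)

  ⟦_⟧ : (Fin n → Bool) → Sub
  ⟦ p ⟧ = tabulate p

  lookup-⟦⟧ : (p : Fin n → Bool) (v : Fin n) → lookup ⟦ p ⟧ v ≡ p v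
  lookup-⟦⟧ p v = lookup∘tabulate p v

  set-ext : (S T : Sub) → (∀ v → lookup S v ≡ lookup T v) → S ≡ T
  set-ext S T h = trans (sym (tabulate∘lookup S)) (trans (tabulate-cong h) (tabulate∘lookup T))

  lookup-complement : (S : Sub) (v : Fin n) → lookup (complement Γ S) v ≡ not (lookup S v)
  lookup-complement S v = lookup-map v not S

  nonempty-elim : (S : Sub) → isNonempty Γ S ≡ true → ∃ λ v → v ∈ₛ S
  nonempty-elim S e = let (v , _ , vS) = any-elim (lookup S) (allFin n) e in v , vS

  nonempty-intro : (S : Sub) {v : Fin n} → v ∈ₛ S → isNonempty Γ S ≡ true
  nonempty-intro S {v} vS = any-intro (lookup S) (∈-allFin v) vS

  subset-elim : (S T : Sub) → subsetᵇ Γ S T ≡ true → ∀ {v} → v ∈ₛ S → v ∈ₛ T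
  subset-elim S T e {v} vS with all-elim (λ u → not (lookup S u) ∨ lookup T u) e (∈-allFin v)
  ... | h rewrite vS = h

  subset-intro : (S T : Sub) → (∀ {v} → v ∈ₛ S → v ∈ₛ T) → subsetᵇ Γ S T ≡ true
  subset-intro S T h = all-intro _ (allFin n) λ {v} _ → clause v
    where
    clause : ∀ v → not (lookup S v) ∨ lookup T v ≡ true
    clause v with lookup S v in vS
    ... | true = h vS
    ... | false = refl

  subset-refute : (S T : Sub) {v : Fin n} → v ∈ₛ S → v ∉ₛ T → subsetᵇ Γ S T ≡ false
  subset-refute S T vS vT with subsetᵇ Γ S T in e
  ... | true with () ← trans (sym (subset-elim S T e vS)) vT
  ... | false = refl

  subset-witness : (S T : Sub) → subsetᵇ Γ S T ≡ false → ∃ λ v → v ∈ₛ S × v ∉ₛ T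
  subset-witness S T e with any? (λ v → (lookup S v ≟ᵇ true) ×-dec (lookup T v ≟ᵇ false))
  ... | yes found = found
  ... | no none = ⊥-elim (true≢false (trans (sym (subset-intro S T inside)) e))
    where
    inside : ∀ {v} → v ∈ₛ S → v ∈ₛ T
    inside {v} vS with lookup T v in vT
    ... | true = refl
    ... | false = ⊥-elim (none (v , vS , vT))

  edge-elim : (P Q : Sub) → edgeBetween Γ P Q ≡ true → ∃₂ λ u w → u ∈ₛ P × w ∈ₛ Q × A u w ≡ true
  edge-elim P Q e with any-elim _ (allFin n) e
  ... | u , _ , e′ with any-elim _ (allFin n) e′
  ... | w , _ , e″ with lookup P u in uP | lookup Q w in wQ | A u w in a
  ... | true | true | true = u , w , uP , wQ , a

  edge-intro : (P Q : Sub) {u w : Fin n} → u ∈ₛ P → w ∈ₛ Q → A u w ≡ true → edgeBetween Γ P Q ≡ true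
  edge-intro P Q {u} {w} uP wQ a = any-intro _ (∈-allFin u) (any-intro _ (∈-allFin w) both)
    where
    both : lookup P u ∧ lookup Q w ∧ A u w ≡ true
    both rewrite uP | wQ | a = refl

  EdgeOut : Sub → Sub → Set
  EdgeOut T S = ∃₂ λ u w → u ∈ₛ T × w ∈ₛ S × w ∉ₛ T × A u w ≡ true

  Connected : Sub → Set
  Connected S = (∃ λ v → v ∈ₛ S) ×
    (∀ (T : Sub) → (∀ {u} → u ∈ₛ T → u ∈ₛ S) → (∃ λ u → u ∈ₛ T) → (∃ λ w → w ∈ₛ S × w ∉ₛ T) → EdgeOut T S)

  lookup-diff : (S T : Sub) (w : Fin n) → lookup (zipWith _∧_ S (complement Γ T)) w ≡ lookup S w ∧ not (lookup T w)
  lookup-diff S T w = trans (lookup-zipWith _∧_ w S (complement Γ T)) (cong (lookup S w ∧_) (lookup-complement T w))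

  connected-elim : (S : Sub) → connectedᵇ Γ S ≡ true → Connected S
  connected-elim S c with isNonempty Γ S in ne
  ... | true = nonempty-elim S ne , crossing
    where
    crossing : ∀ T → (∀ {u} → u ∈ₛ T → u ∈ₛ S) → (∃ λ u → u ∈ₛ T) → (∃ λ w → w ∈ₛ S × w ∉ₛ T) → EdgeOut T S
    crossing T T⊆S (x , xT) (y , yS , yT) with all-elim _ c (allSubsets-complete T)
    ... | clause rewrite subset-intro T S T⊆S | nonempty-intro T xT | subset-refute S T yS yT
      with edge-elim T (zipWith _∧_ S (complement Γ T)) clause
    ... | u , w , uT , wS∖T , a with ∧-not-elim (trans (sym (lookup-diff S T w)) wS∖T)
    ...   | wS , wT = u , w , uT , wS , wT , a
  ... | false with () ← c

  connected-intro : (S : Sub) → Connected S → connectedᵇ Γ S ≡ true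
  connected-intro S ((v , vS) , crossing) rewrite nonempty-intro S vS = all-intro _ (allSubsets n) (λ {T} _ → clause T)
    where
    clause : ∀ T → not (subsetᵇ Γ T S ∧ isNonempty Γ T ∧ not (eqSetᵇ Γ T S)) ∨ edgeBetween Γ T (zipWith _∧_ S (complement Γ T)) ≡ true
    clause T with subsetᵇ Γ T S in T⊆S | isNonempty Γ T in neT | subsetᵇ Γ S T in S⊆T
    ... | false | _ | _ = refl
    ... | true | false | _ = refl
    ... | true | true | true = refl
    ... | true | true | false with subset-witness S T S⊆T
    ... | y , yS , yT with crossing T (subset-elim T S T⊆S) (nonempty-elim T neT) (y , yS , yT)
    ... | u , w , uT , wS , wT , a = edge-intro T (zipWith _∧_ S (complement Γ T)) uT wS∖T a
      where
      wS∖T : lookup (zipWith _∧_ S (complement Γ T)) w ≡ true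
      wS∖T rewrite lookup-diff S T w | wS | wT = refl

  D : ℕ
  D = maxDeg Γ

  deg-split : (S : Sub) (v : Fin n) → deg Γ v ≡ δ_ Γ S v + δ_ Γ (complement Γ S) v
  deg-split S v = trans (cnt-split (A v) (lookup S))
    (cong (λ x → δ_ Γ S v + x) (cnt-ext _ _ λ u → cong (A v u ∧_) (sym (lookup-complement S u))))

  deg≤D : (v : Fin n) → deg Γ v ≤ D
  deg≤D v = max-upper (deg Γ) (∈-allFin v)

  D-attained : ∃ λ v → deg Γ v ≡ D
  D-attained = let (v , e) = max-attained (deg Γ) (∈-allFin (fromℕ< (nonempty Γ))) in v , sym e

  surplus : Sub → Fin n → ℤ
  surplus S v = + δ_ Γ S v ℤ.- + δ_ Γ (complement Γ S) v

  surplus-lower : (S : Sub) (v : Fin n) → - + D ℤ.≤ surplus S v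
  surplus-lower S v = subst (ℤ._≤ surplus S v) (ℤ.+-identityˡ (- + D)) (diff-≤⁺ 0 D _ _ bound)
    where
    open ℕ.≤-Reasoning
    bound : δ_ Γ (complement Γ S) v ≤ δ_ Γ S v + D
    bound = begin
      δ_ Γ (complement Γ S) v                 ≤⟨ ℕ.m≤n+m _ (δ_ Γ S v) ⟩
      δ_ Γ S v + δ_ Γ (complement Γ S) v      ≡⟨ sym (deg-split S v) ⟩
      deg Γ v                                 ≤⟨ deg≤D v ⟩
      D                                       ≤⟨ ℕ.m≤n+m D _ ⟩
      δ_ Γ S v + D                            ∎

  surplus-upper : (S : Sub) (v : Fin n) → surplus S v ℤ.≤ + D
  surplus-upper S v = subst (surplus S v ℤ.≤_) (ℤ.+-identityʳ (+ D)) (diff-≤⁺ _ _ D 0 bound)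
    where
    open ℕ.≤-Reasoning
    bound : δ_ Γ S v + 0 ≤ D + δ_ Γ (complement Γ S) v
    bound = begin
      δ_ Γ S v + 0                            ≡⟨ ℕ.+-identityʳ _ ⟩
      δ_ Γ S v                                ≤⟨ ℕ.m≤m+n _ _ ⟩
      δ_ Γ S v + δ_ Γ (complement Γ S) v      ≡⟨ sym (deg-split S v) ⟩
      deg Γ v                                 ≤⟨ deg≤D v ⟩
      D                                       ≤⟨ ℕ.m≤m+n D _ ⟩
      D + δ_ Γ (complement Γ S) v             ∎

  k≤surplus : (S : Sub) {v : Fin n} → v ∈ₛ S → kIndex Γ S ℤ.≤ surplus S v
  k≤surplus S vS = min-lower (surplus S) (+ D) (sat⁺ (lookup S) vS)

  k-glb : (S : Sub) (c : ℤ) → c ℤ.≤ + D → (∀ {v} → v ∈ₛ S → c ℤ.≤ surplus S v) → c ℤ.≤ kIndex Γ S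
  k-glb S c c≤D h = min-glb (surplus S) (+ D) c _ c≤D (λ m → h (sat⁻ (lookup S) m))

  -D≤k : (S : Sub) → - + D ℤ.≤ kIndex Γ S
  -D≤k S = k-glb S (- + D) (ℤ.≤-trans (ℤ.neg-mono-≤ (+≤+ z≤n)) (+≤+ z≤n)) (λ {v} _ → surplus-lower S v)

  k-attained : (S : Sub) {v : Fin n} → v ∈ₛ S → ∃ λ w → w ∈ₛ S × surplus S w ≡ kIndex Γ S
  k-attained S {v} vS with min-attained (surplus S) (+ D) (filterᵇ (lookup S) (allFin n))
  ... | inj₁ k≡D = v , vS , ℤ.≤-antisym (ℤ.≤-trans (surplus-upper S v) (ℤ.≤-reflexive (sym k≡D))) (k≤surplus S vS)
  ... | inj₂ (w , m , k≡w) = w , sat⁻ (lookup S) m , sym k≡w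

-- If a + d = e + b, a + b ≤ d and e ≤ 1 then a = 0.  (Used with a = δ_S(w),
-- b = δ_S̄(w), d = δ₁: a vertex of surplus e - δ₁ has no neighbour in S.)
no-inner-neighbour : ∀ a b e d → a + d ≡ e + b → a + b ≤ d → e ≤ 1 → a ≡ 0
no-inner-neighbour zero _ _ _ _ _ _ = refl
no-inner-neighbour (suc a) b e d eq a+b≤d e≤1 = ⊥-elim (ℕ.<-irrefl refl (begin-strict
    1 + b                  ≤⟨ s≤s (ℕ.m≤n+m b a) ⟩
    suc a + b              <⟨ ℕ.m<m+n _ (s≤s z≤n) ⟩
    suc a + b + suc a      ≤⟨ ℕ.+-monoˡ-≤ (suc a) a+b≤d ⟩
    d + suc a              ≡⟨ ℕ.+-comm d (suc a) ⟩
    suc a + d              ≡⟨ eq ⟩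
    e + b                  ≤⟨ ℕ.+-monoˡ-≤ b e≤1 ⟩
    1 + b                  ∎))
  where open ℕ.≤-Reasoning

module LowCoefficients (Γ : Graph) where

  open GraphFacts Γ
  open Counting
  open DiffArith

  sing : Fin n → Sub
  sing v = ⟦ (λ u → ⌊ u ≟ᶠ v ⌋) ⟧

  ∈sing : (v : Fin n) → v ∈ₛ sing v
  ∈sing v = trans (lookup-⟦⟧ _ v) (⌊⌋-true (v ≟ᶠ v) refl)

  ∈sing⁻ : {v u : Fin n} → u ∈ₛ sing v → u ≡ v
  ∈sing⁻ {v} {u} h = ⌊⌋-sound (u ≟ᶠ v) (trans (sym (lookup-⟦⟧ _ u)) h)

  ∉sing : {v u : Fin n} → u ≢ v → u ∉ₛ sing v
  ∉sing {v} {u} u≢v = trans (lookup-⟦⟧ _ u) (⌊⌋-false (u ≟ᶠ v) u≢v)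

  sing-injective : ∀ {v w} → sing v ≡ sing w → v ≡ w
  sing-injective {v} e = ∈sing⁻ (subst (v ∈ₛ_) e (∈sing v))

  sing-connected : (v : Fin n) → connectedᵇ Γ (sing v) ≡ true
  sing-connected v = connected-intro (sing v) ((v , ∈sing v) , no-proper-part)
    where
    no-proper-part : ∀ T → (∀ {u} → u ∈ₛ T → u ∈ₛ sing v) → (∃ λ u → u ∈ₛ T) → (∃ λ w → w ∈ₛ sing v × w ∉ₛ T) → EdgeOut T (sing v)
    no-proper-part T T⊆S (x , xT) (y , yS , yT) with ∈sing⁻ (T⊆S xT) | ∈sing⁻ yS
    ... | refl | refl = ⊥-elim (true≢false (trans (sym xT) yT))

  -- k_{v} = -δ(v): all neighbours of v lie outside {v}.
  k-sing : (v : Fin n) → kIndex Γ (sing v) ≡ - + deg Γ v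
  k-sing v = ℤ.≤-antisym (ℤ.≤-trans (k≤surplus (sing v) (∈sing v)) (ℤ.≤-reflexive surplus-v))
    (k-glb (sing v) _ (ℤ.≤-trans (ℤ.neg-mono-≤ (+≤+ z≤n)) (+≤+ z≤n)) (λ uS → ℤ.≤-reflexive (sym (surplus-at uS))))
    where
    no-inner : δ_ Γ (sing v) v ≡ 0
    no-inner = cnt-none _ inner
      where
      inner : ∀ u → A v u ∧ lookup (sing v) u ≡ false
      inner u with u ≟ᶠ v
      ... | yes refl = cong (_∧ lookup (sing v) v) (irrefl Γ v)
      ... | no u≢v = trans (cong (A v u ∧_) (∉sing u≢v)) (∧-zeroʳ (A v u))
    surplus-v : surplus (sing v) v ≡ - + deg Γ v
    surplus-v rewrite deg-split (sing v) v | no-inner = ℤ.+-identityˡ _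
    surplus-at : ∀ {u} → u ∈ₛ sing v → surplus (sing v) u ≡ - + deg Γ v
    surplus-at uS rewrite ∈sing⁻ uS = surplus-v

  neighbour-inside : (S : Sub) → Connected S → {w u : Fin n} → w ∈ₛ S → u ∈ₛ S → u ≢ w → 1 ≤ δ_ Γ S w
  neighbour-inside S (_ , crossing) {w} wS uS u≢w
    with crossing (sing w) (λ xT → subst (_∈ₛ S) (sym (∈sing⁻ xT)) wS) (w , ∈sing w) (_ , uS , ∉sing u≢w)
  ... | x , y , xT , yS , _ , a rewrite ∈sing⁻ xT = cnt-pos _ {y} (trans (cong (_∧ lookup S y) a) yS)

  exponent : Sub → ℤ
  exponent S = + n ℤ.+ kIndex Γ S

  contributes : ℤ → Sub → Bool
  contributes j S = connectedᵇ Γ S ∧ ⌊ exponent S ℤ.≟ j ⌋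

  coeff-positive : (S : Sub) → connectedᵇ Γ S ≡ true → 1 ≤ allianceCoeff Γ (exponent S)
  coeff-positive S c = unique-length ([] ∷ []) λ { (here refl) →
    ∈-filterᵇ⁺ (contributes (exponent S)) (allSubsets-complete S) contributes-S }
    where
    contributes-S : contributes (exponent S) S ≡ true
    contributes-S rewrite c = ⌊⌋-true (exponent S ℤ.≟ exponent S) refl

  coeff-witness : (j : ℤ) → 1 ≤ allianceCoeff Γ j → ∃ λ S → connectedᵇ Γ S ≡ true × exponent S ≡ j
  coeff-witness j pos with filterᵇ (contributes j) (allSubsets n) in e
  ... | S ∷ _ with ∈-filterᵇ⁻ (contributes j) {xs = allSubsets n} (subst (S ∈_) (sym e) (here refl))
  ...   | _ , cS = S , proj₁ (∧-elim cS) , ⌊⌋-sound (exponent S ℤ.≟ j) (proj₂ (∧-elim {connectedᵇ Γ S} cS))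

  lowest : ℤ
  lowest = + n ℤ.- + D

  exponent-lower : (S : Sub) → lowest ℤ.≤ exponent S
  exponent-lower S = ℤ.+-monoʳ-≤ (+ n) (-D≤k S)

  exponent-sing : (v : Fin n) → exponent (sing v) ≡ + n ℤ.- + deg Γ v
  exponent-sing v = cong (λ k → + n ℤ.+ k) (k-sing v)

  short : ℕ → Fin n → Bool
  short e v = deg Γ v + e ≡ᵇ D

  -- For e ≤ 1 the coefficient of x^(n - δ₁ + e) counts the vertices of
  -- degree δ₁ - e: only singletons have such a small index of alliance.
  low-coefficient : (e : ℕ) → e ≤ 1 → allianceCoeff Γ (lowest ℤ.+ + e) ≡ cnt (short e)
  low-coefficient e e≤1 = ℕ.≤-antisym
    (ℕ.≤-trans (unique-length (filter⁺ (T? ∘ contributes j) (allSubsets-unique n)) only-singletons) (ℕ.≤-reflexive (length-map sing shorts)))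
    (ℕ.≤-trans (ℕ.≤-reflexive (sym (length-map sing shorts))) (unique-length (Unique.map⁺ sing-injective (filter⁺ (T? ∘ short e) (allFin⁺ n))) singletons-contribute))
    where
    j : ℤ
    j = lowest ℤ.+ + e
    shorts : List (Fin n)
    shorts = filterᵇ (short e) (allFin n)

    singletons-contribute : ∀ {S} → S ∈ map sing shorts → S ∈ filterᵇ (contributes j) (allSubsets n)
    singletons-contribute m with ∈-map⁻ sing m
    ... | v , v∈ , refl = ∈-filterᵇ⁺ (contributes j) (allSubsets-complete (sing v)) contributes-v
      where
      deficit : + 0 ℤ.- + deg Γ v ≡ + e ℤ.- + D
      deficit = diff-≡⁺ 0 (deg Γ v) e D (trans (sym (≡ᵇ-sound (sat⁻ (short e) v∈))) (ℕ.+-comm (deg Γ v) e))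
      contributes-v : contributes j (sing v) ≡ true
      contributes-v rewrite sing-connected v = ⌊⌋-true (exponent (sing v) ℤ.≟ j)
        (trans (exponent-sing v) (trans (cong (λ x → + n ℤ.+ x) (trans (sym (ℤ.+-identityˡ (- + deg Γ v))) deficit)) (sym (relative n D e))))

    only-singletons : ∀ {S} → S ∈ filterᵇ (contributes j) (allSubsets n) → S ∈ map sing shorts
    only-singletons {S} m with ∧-elim (proj₂ (∈-filterᵇ⁻ (contributes j) {xs = allSubsets n} m))
    ... | c , at-j with connected-elim S c
    ... | conn@((v , vS) , _) with k-attained S vS
    ... | w , wS , surplus≡k = subst (_∈ map sing shorts) (sym S≡w) (∈-map⁺ sing (sat⁺ (short e) (≡ᵇ-true short-w)))
      where
      inner outer : ℕ
      inner = δ_ Γ S w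
      outer = δ_ Γ (complement Γ S) w
      k-value : kIndex Γ S ≡ + e ℤ.- + D
      k-value = +-cancelˡ-≡ (+ n) _ _ (trans (⌊⌋-sound (exponent S ℤ.≟ j) at-j) (relative n D e))
      balance : inner + D ≡ e + outer
      balance = diff-≡⁻ inner outer e D (trans surplus≡k k-value)
      inner≡0 : inner ≡ 0
      inner≡0 = no-inner-neighbour inner outer e D balance (ℕ.≤-trans (ℕ.≤-reflexive (sym (deg-split S w))) (deg≤D w)) e≤1
      short-w : deg Γ w + e ≡ D
      short-w = begin
        deg Γ w + e           ≡⟨ cong (_+ e) (trans (deg-split S w) (cong (_+ outer) inner≡0)) ⟩
        outer + e             ≡⟨ ℕ.+-comm outer e ⟩
        e + outer             ≡⟨ sym balance ⟩
        inner + D             ≡⟨ cong (_+ D) inner≡0 ⟩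
        D                     ∎
        where open ≡-Reasoning
      S≡w : S ≡ sing w
      S≡w = set-ext S (sing w) λ u → trans (only-w u) (sym (lookup-⟦⟧ _ u))
        where
        only-w : ∀ u → lookup S u ≡ ⌊ u ≟ᶠ w ⌋
        only-w u with u ≟ᶠ w
        ... | yes refl = wS
        ... | no u≢w with lookup S u in uS
        ...   | false = refl
        ...   | true = ⊥-elim (ℕ.<-irrefl refl (ℕ.≤-trans (neighbour-inside S conn wS uS u≢w) (ℕ.≤-reflexive inner≡0)))

module Components (Γ : Graph) where

  open GraphFacts Γ
  open LowCoefficients Γ using (sing; ∈sing; ∈sing⁻; sing-connected)
  open Counting
  open BoolFolds

  reached : Sub → Fin n → Bool
  reached S u = lookup S u ∨ any (λ w → lookup S w ∧ A w u) (allFin n)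

  grow : Sub → Sub
  grow S = ⟦ reached S ⟧

  ∈grow : (S : Sub) {u : Fin n} → u ∈ₛ S → u ∈ₛ grow S
  ∈grow S {u} uS rewrite lookup-⟦⟧ (reached S) u | uS = refl

  ∈grow-adj : (S : Sub) {w u : Fin n} → w ∈ₛ S → A w u ≡ true → u ∈ₛ grow S
  ∈grow-adj S {w} {u} wS a rewrite lookup-⟦⟧ (reached S) u with lookup S u
  ... | true = refl
  ... | false = any-intro _ (∈-allFin w) (subst (λ b → b ∧ A w u ≡ true) (sym wS) a)

  ∈grow⁻ : (S : Sub) {u : Fin n} → u ∈ₛ grow S → u ∈ₛ S ⊎ ∃ λ w → w ∈ₛ S × A w u ≡ true
  ∈grow⁻ S {u} h with lookup S u in uS | trans (sym (lookup-⟦⟧ (reached S) u)) h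
  ... | true | _ = inj₁ refl
  ... | false | found with any-elim _ (allFin n) found
  ...   | w , _ , wA = inj₂ (w , ∧-elim wA)

  _∩_ : Sub → Sub → Sub
  T ∩ S = ⟦ (λ u → lookup T u ∧ lookup S u) ⟧

  lookup-∩ : (T S : Sub) (u : Fin n) → lookup (T ∩ S) u ≡ lookup T u ∧ lookup S u
  lookup-∩ T S = lookup-⟦⟧ _

  grow-connected : (S : Sub) → Connected S → Connected (grow S)
  grow-connected S ((v , vS) , crossing) = (v , ∈grow S vS) , crossing′
    where
    crossing′ : ∀ T → (∀ {u} → u ∈ₛ T → u ∈ₛ grow S) → (∃ λ u → u ∈ₛ T) → (∃ λ w → w ∈ₛ grow S × w ∉ₛ T) → EdgeOut T (grow S)
    crossing′ T T⊆ (x , xT) (y , yG , yT)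
      with any? (λ z → (lookup S z ≟ᵇ true) ×-dec (lookup T z ≟ᵇ true))
         | any? (λ z → (lookup S z ≟ᵇ true) ×-dec (lookup T z ≟ᵇ false))
    -- T meets S without containing it: use the connectivity of S on T ∩ S.
    ... | yes (z , zS , zT) | yes (z′ , z′S , z′T)
      with crossing (T ∩ S) (λ {u} uT∩S → proj₂ (∧-elim (trans (sym (lookup-∩ T S u)) uT∩S)))
                    (z , trans (lookup-∩ T S z) (cong₂ _∧_ zT zS)) (z′ , z′S , trans (lookup-∩ T S z′) (cong₂ _∧_ z′T z′S))
    ... | u , w , uT∩S , wS , wT∩S , a =
      u , w , proj₁ (∧-elim (trans (sym (lookup-∩ T S u)) uT∩S)) , ∈grow S wS ,
      ¬-not (λ wT → true≢false (trans (trans (sym (cong₂ _∧_ wT wS)) (sym (lookup-∩ T S w))) wT∩S)) , a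
    -- T avoids S: x ∉ S has a neighbour in S, which lies outside T.
    crossing′ T T⊆ (x , xT) (y , yG , yT) | no T∩S=∅ | _ with ∈grow⁻ S (T⊆ xT)
    ...   | inj₁ xS = ⊥-elim (T∩S=∅ (x , xS , xT))
    ...   | inj₂ (w , wS , a) = x , w , xT , ∈grow S wS , ¬-not (λ wT → T∩S=∅ (w , wS , wT)) , adj-sym a
    -- S ⊆ T: y ∉ T lies outside S, so it has a neighbour in S ⊆ T.
    crossing′ T T⊆ (x , xT) (y , yG , yT) | yes _ | no S⊆T with ∈grow⁻ S yG
    ...   | inj₁ yS = ⊥-elim (S⊆T (y , yS , yT))
    ...   | inj₂ (w , wS , a) = w , y , ¬-not (λ wT → S⊆T (w , wS , wT)) , yG , yT , a

  grow-step : (S : Sub) → grow S ≡ S ⊎ suc (cnt (lookup S)) ≤ cnt (lookup (grow S))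
  grow-step S with any? (λ u → (lookup (grow S) u ≟ᵇ true) ×-dec (lookup S u ≟ᵇ false))
  ... | yes (u , uG , uS) = inj₂ (cnt-strict (lookup S) (lookup (grow S)) (λ _ → ∈grow S) uG uS)
  ... | no none = inj₁ (set-ext (grow S) S same)
    where
    same : ∀ u → lookup (grow S) u ≡ lookup S u
    same u with lookup S u in uS
    ... | true = ∈grow S uS
    ... | false = ¬-not (λ uG → none (u , uG , uS))

  ball : Fin n → ℕ → Sub
  ball v zero = sing v
  ball v (suc i) = grow (ball v i)

  ball-connected : (v : Fin n) (i : ℕ) → Connected (ball v i)
  ball-connected v zero = connected-elim (sing v) (sing-connected v)
  ball-connected v (suc i) = grow-connected (ball v i) (ball-connected v i)

  centre∈ball : (v : Fin n) (i : ℕ) → v ∈ₛ ball v i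
  centre∈ball v zero = ∈sing v
  centre∈ball v (suc i) = ∈grow (ball v i) (centre∈ball v i)

  ball-invariant : (v : Fin n) (Q : Fin n → Set) → (∀ {u w} → Q u → A u w ≡ true → Q w) → Q v → (i : ℕ) → ∀ {u} → u ∈ₛ ball v i → Q u
  ball-invariant v Q step Qv zero uB = subst Q (sym (∈sing⁻ uB)) Qv
  ball-invariant v Q step Qv (suc i) uB with ∈grow⁻ (ball v i) uB
  ... | inj₁ uB′ = ball-invariant v Q step Qv i uB′
  ... | inj₂ (w , wB , a) = step (ball-invariant v Q step Qv i wB) a

  ball-grows : (v : Fin n) (i : ℕ) → (∃ λ j → grow (ball v j) ≡ ball v j) ⊎ suc i ≤ cnt (lookup (ball v i))
  ball-grows v zero = inj₂ (cnt-pos (lookup (ball v zero)) (centre∈ball v zero))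
  ball-grows v (suc i) with ball-grows v i | grow-step (ball v i)
  ... | inj₁ stable | _ = inj₁ stable
  ... | inj₂ _ | inj₁ stable = inj₁ (i , stable)
  ... | inj₂ size | inj₂ bigger = inj₂ (ℕ.≤-trans (s≤s size) bigger)

  ball-stabilises : (v : Fin n) → ∃ λ j → grow (ball v j) ≡ ball v j
  ball-stabilises v with ball-grows v n
  ... | inj₁ stable = stable
  ... | inj₂ too-big = ⊥-elim (ℕ.<-irrefl refl (ℕ.≤-trans too-big (cnt≤n _)))

  ClosedUnderAdjacency : Sub → Set
  ClosedUnderAdjacency K = ∀ {u w} → u ∈ₛ K → A u w ≡ true → w ∈ₛ K

  record Component (v : Fin n) (Q : Fin n → Set) : Set where
    field
      K         : Sub
      connected : connectedᵇ Γ K ≡ true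
      closed    : ClosedUnderAdjacency K
      inherits  : ∀ {u} → u ∈ₛ K → Q u

  component : (v : Fin n) (Q : Fin n → Set) → (∀ {u w} → Q u → A u w ≡ true → Q w) → Q v → Component v Q
  component v Q step Qv = record
    { K = ball v j
    ; connected = connected-intro (ball v j) (ball-connected v j)
    ; closed = λ {_} {w} uK a → subst (w ∈ₛ_) stable (∈grow-adj (ball v j) uK a)
    ; inherits = ball-invariant v Q step Qv j
    }
    where
    j : ℕ
    j = proj₁ (ball-stabilises v)
    stable : grow (ball v j) ≡ ball v j
    stable = proj₂ (ball-stabilises v)

  -- An adjacency-closed K has δ_K̄ = 0 on K, so k_K is its minimum degree.
  closed-k : (K : Sub) → ClosedUnderAdjacency K → (c : ℕ) → c ≤ D → (∀ {u} → u ∈ₛ K → c ≤ deg Γ u) → + c ℤ.≤ kIndex Γ K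
  closed-k K closed c c≤D c≤deg = k-glb K (+ c) (+≤+ c≤D) λ {u} uK → ℤ.≤-trans (+≤+ (c≤deg uK)) (ℤ.≤-reflexive (sym (surplus-deg uK)))
    where
    no-outer : ∀ {u} → u ∈ₛ K → δ_ Γ (complement Γ K) u ≡ 0
    no-outer {u} uK = cnt-none _ λ w → outside w
      where
      outside : ∀ w → A u w ∧ lookup (complement Γ K) w ≡ false
      outside w rewrite lookup-complement K w with A u w in a
      ... | false = refl
      ... | true rewrite closed uK a = refl
    surplus-deg : ∀ {u} → u ∈ₛ K → surplus K u ≡ + deg Γ u
    surplus-deg {u} uK rewrite deg-split K u | no-outer uK = refl

least : ∀ {m} (p : Fin m → Bool) → (∃ λ v → p v ≡ true) → ∃ λ v → p v ≡ true × (∀ {u} → p u ≡ true → toℕ v ≤ toℕ u)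
least {suc m} p (v , pv) with p Fin.zero in p0
... | true = Fin.zero , p0 , λ _ → z≤n
... | false with v
...   | Fin.zero = ⊥-elim (true≢false (trans (sym pv) p0))
...   | Fin.suc v′ with least (λ u → p (Fin.suc u)) (v′ , pv)
...     | w , pw , w-least = Fin.suc w , pw , above
  where
  above : ∀ {u} → p u ≡ true → suc (toℕ w) ≤ toℕ u
  above {Fin.zero} pu = ⊥-elim (true≢false (trans (sym pu) p0))
  above {Fin.suc u} pu = s≤s (w-least pu)

module PathFacts (t : ℕ) (2≤t : 2 ≤ t) where

  P : Graph
  P = pathGraph t (ℕ.≤-trans (ℕ.n≤1+n 1) 2≤t)

  open GraphFacts P
  open Counting {t}

  adj-right : {i j : Fin t} → suc (toℕ i) ≡ toℕ j → pathAdj t i j ≡ true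
  adj-right {i} {j} e rewrite ≡ᵇ-true e = refl

  adj-left : {i j : Fin t} → suc (toℕ j) ≡ toℕ i → pathAdj t i j ≡ true
  adj-left {i} {j} e rewrite ≡ᵇ-true e = ∨-zeroʳ _

  adj-positions : {i j : Fin t} → pathAdj t i j ≡ true → suc (toℕ i) ≡ toℕ j ⊎ suc (toℕ j) ≡ toℕ i
  adj-positions {i} {j} a with suc (toℕ i) ≡ᵇ toℕ j in r | suc (toℕ j) ≡ᵇ toℕ i in l
  ... | true | _ = inj₁ (≡ᵇ-sound r)
  ... | false | true = inj₂ (≡ᵇ-sound l)

  at : (k : ℕ) → k < t → Fin t
  at k k<t = fromℕ< k<t

  one-at : (f : Fin t → ℕ) → (∀ {u w} → f u ≡ f w → u ≡ w) → (k : ℕ) → cnt (λ u → f u ≡ᵇ k) ≤ 1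
  one-at f f-inj k = cnt≤1 _ λ {u} {w} fu fw → f-inj (trans (≡ᵇ-sound {f u} {k} fu) (sym (≡ᵇ-sound {f w} {k} fw)))

  one-at′ : (f : Fin t → ℕ) → (∀ {u w} → f u ≡ f w → u ≡ w) → (k : ℕ) → cnt (λ u → k ≡ᵇ f u) ≤ 1
  one-at′ f f-inj k = cnt≤1 _ λ {u} {w} fu fw → f-inj (trans (sym (≡ᵇ-sound {k} {f u} fu)) (≡ᵇ-sound {k} {f w} fw))

  suc-toℕ-injective : ∀ {u w : Fin t} → suc (toℕ u) ≡ suc (toℕ w) → u ≡ w
  suc-toℕ-injective e = toℕ-injective (ℕ.suc-injective e)

  deg≤2 : ∀ i → deg P i ≤ 2
  deg≤2 i = ℕ.≤-trans (cnt-or (λ u → suc (toℕ i) ≡ᵇ toℕ u) (λ u → suc (toℕ u) ≡ᵇ toℕ i))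
    (ℕ.+-mono-≤ (one-at′ toℕ toℕ-injective (suc (toℕ i))) (one-at (λ u → suc (toℕ u)) suc-toℕ-injective (toℕ i)))

  -- Every vertex has a neighbour (this uses t ≥ 2).
  deg≥1 : ∀ i → 1 ≤ deg P i
  deg≥1 i with suc (toℕ i) ℕ.<? t
  ... | yes i+1<t = cnt-pos (pathAdj t i) (adj-right {i} {at _ i+1<t} (sym (toℕ-fromℕ< i+1<t)))
  ... | no i+1≮t = from-left (toℕ i) refl
    where
    from-left : ∀ m → toℕ i ≡ m → 1 ≤ deg P i
    from-left zero ti = ⊥-elim (i+1≮t (subst (λ m → suc m < t) (sym ti) 2≤t))
    from-left (suc k) ti = cnt-pos (pathAdj t i) (adj-left {i} {at k k<t} (trans (cong suc (toℕ-fromℕ< k<t)) (sym ti)))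
      where
      k<t : k < t
      k<t = ℕ.≤-trans (ℕ.n≤1+n _) (subst (_< t) ti (toℕ<n i))

  leaf-is-end : ∀ i → deg P i ≡ 1 → toℕ i ≡ 0 ⊎ suc (toℕ i) ≡ t
  leaf-is-end i d = ends (toℕ i) refl
    where
    ends : ∀ m → toℕ i ≡ m → toℕ i ≡ 0 ⊎ suc (toℕ i) ≡ t
    ends zero ti = inj₁ ti
    ends (suc k) ti with suc (suc k) ℕ.≟ t
    ... | yes end = inj₂ (trans (cong suc ti) end)
    ... | no not-end = ⊥-elim (ℕ.<-irrefl (sym d) (two≤cnt _ distinct left right))
      where
      k+2<t : suc (suc k) < t
      k+2<t = ℕ.≤∧≢⇒< (subst (_< t) ti (toℕ<n i)) not-end
      k<t : k < t
      k<t = ℕ.≤-trans (ℕ.n≤1+n _) (ℕ.<⇒≤ k+2<t)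
      distinct : at k k<t ≢ at _ k+2<t
      distinct e = ℕ.<-irrefl (trans (sym (toℕ-fromℕ< k<t)) (trans (cong toℕ e) (toℕ-fromℕ< k+2<t))) (ℕ.n≤1+n _)
      left : pathAdj t i (at k k<t) ≡ true
      left = adj-left (trans (cong suc (toℕ-fromℕ< k<t)) (sym ti))
      right : pathAdj t i (at _ k+2<t) ≡ true
      right = adj-right (trans (cong suc ti) (sym (toℕ-fromℕ< k+2<t)))

  leaves≤2 : cnt (λ i → deg P i ≡ᵇ 1) ≤ 2
  leaves≤2 = ℕ.≤-trans (cnt-mono _ (λ u → (toℕ u ≡ᵇ 0) ∨ (suc (toℕ u) ≡ᵇ t)) end)
    (ℕ.≤-trans (cnt-or _ _) (ℕ.+-mono-≤ (one-at toℕ toℕ-injective 0) (one-at (λ u → suc (toℕ u)) suc-toℕ-injective t)))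
    where
    end : ∀ u → (deg P u ≡ᵇ 1) ≡ true → (toℕ u ≡ᵇ 0) ∨ (suc (toℕ u) ≡ᵇ t) ≡ true
    end u d with leaf-is-end u (≡ᵇ-sound d)
    ... | inj₁ e rewrite ≡ᵇ-true e = refl
    ... | inj₂ e rewrite ≡ᵇ-true e = ∨-zeroʳ _

  first : Fin t
  first = at 0 (ℕ.≤-trans (s≤s z≤n) 2≤t)

  first-leaf : deg P first ≡ 1
  first-leaf = ℕ.≤-antisym (ℕ.≤-trans (cnt-mono _ _ next-only) (one-at′ toℕ toℕ-injective 1)) (deg≥1 first)
    where
    next-only : ∀ u → pathAdj t first u ≡ true → (1 ≡ᵇ toℕ u) ≡ true
    next-only u a rewrite toℕ-fromℕ< (ℕ.≤-trans (s≤s {0} z≤n) 2≤t) | ∨-identityʳ (1 ≡ᵇ toℕ u) = a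

  -- Every nonempty S has k_S ≤ 1: its least vertex has at most one
  -- neighbour in S, namely its successor.
  k≤1 : (S : Sub) → (∃ λ v → v ∈ₛ S) → kIndex P S ℤ.≤ + 1
  k≤1 S nonempty with least (lookup S) nonempty
  ... | v , vS , v-least = ℤ.≤-trans (k≤surplus S vS) (ℤ.≤-trans (ℤ.i-j≤i (+ δ_ P S v) (+ δ_ P (complement P S) v)) (+≤+ inner≤1))
    where
    inner≤1 : δ_ P S v ≤ 1
    inner≤1 = ℕ.≤-trans (cnt-mono _ (λ u → suc (toℕ v) ≡ᵇ toℕ u) successor) (one-at′ toℕ toℕ-injective (suc (toℕ v)))
      where
      successor : ∀ u → pathAdj t v u ∧ lookup S u ≡ true → (suc (toℕ v) ≡ᵇ toℕ u) ≡ true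
      successor u a∧uS with ∧-elim a∧uS
      ... | a , uS with adj-positions {v} {u} a
      ...   | inj₁ e = ≡ᵇ-true e
      ...   | inj₂ e = ⊥-elim (ℕ.<-irrefl refl (ℕ.≤-trans (ℕ.≤-reflexive e) (v-least uS)))

-- Equal alliance polynomials: every exponent of one graph is an exponent
-- of the other, so the lowest exponent of one bounds that of the other.
module Transfer (Γ Δ : Graph) (same : SameAlliancePoly Γ Δ) where

  private
    module G = GraphFacts Γ
    module H = GraphFacts Δ
    module LG = LowCoefficients Γ
    module LH = LowCoefficients Δ

  transfer : (S : G.Sub) → connectedᵇ Γ S ≡ true → ∃ λ S′ → connectedᵇ Δ S′ ≡ true × LH.exponent S′ ≡ LG.exponent S
  transfer S c = LH.coeff-witness _ (subst (1 ≤_) (same _) (LG.coeff-positive S c))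

  lowest-≤ : LH.lowest ℤ.≤ LG.lowest
  lowest-≤ with G.D-attained
  ... | v , deg-v with transfer (LG.sing v) (LG.sing-connected v)
  ...   | S′ , _ , e = ℤ.≤-trans (LH.exponent-lower S′) (ℤ.≤-reflexive (trans e (trans (LG.exponent-sing v) (cong (λ d → + G.n ℤ.- + d) deg-v))))

module SamePolynomial (Γ Δ : Graph) (same : SameAlliancePoly Γ Δ) where

  private
    module LG = LowCoefficients Γ
    module LH = LowCoefficients Δ
  open Counting using (cnt)

  same-lowest : LG.lowest ≡ LH.lowest
  same-lowest = ℤ.≤-antisym (Transfer.lowest-≤ Δ Γ (λ j → sym (same j))) (Transfer.lowest-≤ Γ Δ same)

  same-short : (e : ℕ) → e ≤ 1 → cnt (LG.short e) ≡ cnt (LH.short e)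
  same-short e e≤1 = begin
    cnt (LG.short e)                     ≡⟨ sym (LG.low-coefficient e e≤1) ⟩
    allianceCoeff Γ (LG.lowest ℤ.+ + e)  ≡⟨ same _ ⟩
    allianceCoeff Δ (LG.lowest ℤ.+ + e)  ≡⟨ cong (λ ℓ → allianceCoeff Δ (ℓ ℤ.+ + e)) same-lowest ⟩
    allianceCoeff Δ (LH.lowest ℤ.+ + e)  ≡⟨ LH.low-coefficient e e≤1 ⟩
    cnt (LH.short e)                     ∎
    where open ≡-Reasoning

leaves-short : (Γ : Graph) → 1 ≤ maxDeg Γ → Counting.cnt (λ v → deg Γ v ≡ᵇ 1) ≡ Counting.cnt (LowCoefficients.short Γ (maxDeg Γ ∸ 1))
leaves-short Γ D≥1 = Counting.cnt-ext (λ v → deg Γ v ≡ᵇ 1) (LowCoefficients.short Γ D-1) λ v → begin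
  deg Γ v ≡ᵇ 1              ≡⟨ sym (≡ᵇ-cancelˡ D-1 (deg Γ v) 1) ⟩
  D-1 + deg Γ v ≡ᵇ D-1 + 1  ≡⟨ cong₂ _≡ᵇ_ (ℕ.+-comm D-1 (deg Γ v)) (trans (ℕ.+-comm D-1 1) (ℕ.m+[n∸m]≡n D≥1)) ⟩
  deg Γ v + D-1 ≡ᵇ D        ∎
  where
  open ≡-Reasoning
  D D-1 : ℕ
  D = maxDeg Γ
  D-1 = D ∸ 1

not-both-short : ∀ d m → (d + 0 ≡ᵇ m) ≡ true → (d + 1 ≡ᵇ m) ≡ false
not-both-short d m d≡m with d + 1 ≡ᵇ m in d+1≡m
... | false = refl
... | true = ⊥-elim (ℕ.<-irrefl (trans (sym (ℕ.+-identityʳ d)) (trans (≡ᵇ-sound d≡m) (sym (≡ᵇ-sound d+1≡m))))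
                               (ℕ.≤-reflexive (ℕ.+-comm 1 d)))

near-max : ∀ d m → 1 ≤ d → d ≤ m → m ≤ 2 → (d + 0 ≡ᵇ m) ∨ (d + 1 ≡ᵇ m) ≡ true
near-max 1 1 _ _ _ = refl
near-max 1 2 _ _ _ = refl
near-max 2 2 _ _ _ = refl
near-max 2 1 _ (s≤s ()) _
near-max (suc (suc (suc _))) _ _ d≤m m≤2 with ℕ.≤-trans d≤m m≤2
... | s≤s (s≤s ())
near-max _ (suc (suc (suc _))) _ _ (s≤s (s≤s ()))

module LikeAPath (t : ℕ) (2≤t : 2 ≤ t) (Γ : Graph) (same : SameAlliancePoly Γ (PathFacts.P t 2≤t)) where

  open PathFacts t 2≤t using (P; first; first-leaf) renaming (deg≥1 to path-deg≥1; deg≤2 to path-deg≤2; leaves≤2 to path-leaves≤2; k≤1 to path-k≤1)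
  module G = GraphFacts Γ
  module H = GraphFacts P
  module LG = LowCoefficients Γ
  module LH = LowCoefficients P
  open SamePolynomial Γ P same
  open Transfer Γ P same using (transfer)
  open DiffArith
  open Counting
  open ℕ.≤-Reasoning

  n D M : ℕ
  n = G.n
  D = G.D
  M = H.D

  M≤2 : M ≤ 2
  M≤2 = let (i , e) = H.D-attained in subst (_≤ 2) e (path-deg≤2 i)

  M≥1 : 1 ≤ M
  M≥1 = ℕ.≤-trans (path-deg≥1 first) (H.deg≤D first)

  -- n + M = t + δ₁(Γ), from the equal lowest exponents.
  balance : n + M ≡ t + D
  balance = diff-≡⁻ n D t M same-lowest

  shorts≤n : cnt (LG.short 0) + cnt (LG.short 1) ≤ n
  shorts≤n = ℕ.≤-trans (ℕ.≤-reflexive (sym (cnt-disjoint (LG.short 0) (LG.short 1) (λ v → not-both-short (deg Γ v) D))))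
                       (cnt≤n (λ v → LG.short 0 v ∨ LG.short 1 v))

  path-near-max : ∀ i → LH.short 0 i ∨ LH.short 1 i ≡ true
  path-near-max i = near-max (deg P i) M (path-deg≥1 i) (H.deg≤D i) M≤2

  t≤shorts : t ≤ cnt (LH.short 0) + cnt (LH.short 1)
  t≤shorts = begin
    t                                        ≡⟨ sym (cnt-all {t}) ⟩
    cnt {t} (λ _ → true)                     ≡⟨ cnt-ext (λ _ → true) (λ i → LH.short 0 i ∨ LH.short 1 i) (sym ∘ path-near-max) ⟩
    cnt (λ i → LH.short 0 i ∨ LH.short 1 i)  ≤⟨ cnt-or (LH.short 0) (LH.short 1) ⟩
    cnt (LH.short 0) + cnt (LH.short 1)      ∎

  t≤n : t ≤ n
  t≤n = begin
    t                                    ≤⟨ t≤shorts ⟩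
    cnt (LH.short 0) + cnt (LH.short 1)  ≡⟨ sym (cong₂ _+_ (same-short 0 z≤n) (same-short 1 ℕ.≤-refl)) ⟩
    cnt (LG.short 0) + cnt (LG.short 1)  ≤⟨ shorts≤n ⟩
    n                                    ∎

  D≥1 : 1 ≤ D
  D≥1 = ℕ.+-cancelˡ-≤ t 1 D (begin
    t + 1  ≤⟨ ℕ.+-monoˡ-≤ 1 t≤n ⟩
    n + 1  ≤⟨ ℕ.+-monoʳ-≤ n M≥1 ⟩
    n + M  ≡⟨ balance ⟩
    t + D  ∎)

  -- Every connected S of Γ has exponent at most t + 1, as in P_t.
  exponent≤t+1 : (S : G.Sub) → connectedᵇ Γ S ≡ true → LG.exponent S ℤ.≤ + t ℤ.+ + 1
  exponent≤t+1 S c = ℤ.≤-trans (ℤ.≤-reflexive (sym e)) (ℤ.+-monoʳ-≤ (+ t) (path-k≤1 S′ (proj₁ (H.connected-elim S′ c′))))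
    where
    S′ : H.Sub
    S′ = proj₁ (transfer S c)
    c′ : connectedᵇ P S′ ≡ true
    c′ = proj₁ (proj₂ (transfer S c))
    e : LH.exponent S′ ≡ LG.exponent S
    e = proj₂ (proj₂ (transfer S c))

  -- The component of a vertex of maximum degree has index at least 1.
  n≤t : n ≤ t
  n≤t = ℕ.+-cancelʳ-≤ 1 n t (ℤ.drop‿+≤+ (ℤ.≤-trans
          (ℤ.+-monoʳ-≤ (+ n) (Components.closed-k Γ K closed 1 D≥1 inherits)) (exponent≤t+1 K connected)))
    where
    v : Fin n
    v = proj₁ G.D-attained
    has-neighbour : ∀ {u w} → 1 ≤ deg Γ u → G.A u w ≡ true → 1 ≤ deg Γ w
    has-neighbour {u} {w} _ a = cnt-pos (G.A w) (G.adj-sym a)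
    open Components.Component (Components.component Γ v (λ u → 1 ≤ deg Γ u) has-neighbour (subst (1 ≤_) (sym (proj₂ G.D-attained)) D≥1))

  n≡t : n ≡ t
  n≡t = ℕ.≤-antisym n≤t t≤n

  D≡M : D ≡ M
  D≡M = ℕ.+-cancelˡ-≡ t D M (trans (sym balance) (cong (_+ M) n≡t))

  Γ-near-max : ∀ v → LG.short 0 v ∨ LG.short 1 v ≡ true
  Γ-near-max = cnt-cover (LG.short 0) (LG.short 1) (λ v → not-both-short (deg Γ v) D) (begin
    n                                    ≡⟨ n≡t ⟩
    t                                    ≤⟨ t≤shorts ⟩
    cnt (LH.short 0) + cnt (LH.short 1)  ≡⟨ sym (cong₂ _+_ (same-short 0 z≤n) (same-short 1 ℕ.≤-refl)) ⟩
    cnt (LG.short 0) + cnt (LG.short 1)  ∎)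

  short-realised : ∀ e → e ≤ 1 → ∀ {v} → LG.short e v ≡ true → ∃ λ i → deg P i ≡ deg Γ v
  short-realised e e≤1 {v} sv = i , ℕ.+-cancelʳ-≡ e (deg P i) (deg Γ v) (trans a (trans (sym D≡M) (sym b)))
    where
    witness : ∃ λ i → LH.short e i ≡ true
    witness = cnt-witness (LH.short e) (subst (1 ≤_) (same-short e e≤1) (cnt-pos (LG.short e) sv))
    i : Fin t
    i = proj₁ witness
    si : LH.short e i ≡ true
    si = proj₂ witness
    a : deg P i + e ≡ M
    a = ≡ᵇ-sound {deg P i + e} {M} si
    b : deg Γ v + e ≡ D
    b = ≡ᵇ-sound {deg Γ v + e} {D} sv

  degree-realised : ∀ v → ∃ λ i → deg P i ≡ deg Γ v
  degree-realised v = realise (∨-elim (Γ-near-max v))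
    where
    realise : LG.short 0 v ≡ true ⊎ LG.short 1 v ≡ true → ∃ λ i → deg P i ≡ deg Γ v
    realise (inj₁ short₀) = short-realised 0 z≤n short₀
    realise (inj₂ short₁) = short-realised 1 ℕ.≤-refl short₁

  deg≥1 : ∀ v → 1 ≤ deg Γ v
  deg≥1 v = let (i , e) = degree-realised v in subst (1 ≤_) e (path-deg≥1 i)

  deg≤2 : ∀ v → deg Γ v ≤ 2
  deg≤2 v = let (i , e) = degree-realised v in subst (_≤ 2) e (path-deg≤2 i)

  same-leaves : cnt (λ v → deg Γ v ≡ᵇ 1) ≡ cnt (λ i → deg P i ≡ᵇ 1)
  same-leaves = begin-equality
    cnt (λ v → deg Γ v ≡ᵇ 1)  ≡⟨ leaves-short Γ D≥1 ⟩
    cnt (LG.short (D ∸ 1))    ≡⟨ same-short (D ∸ 1) (ℕ.∸-monoˡ-≤ 1 (subst (_≤ 2) (sym D≡M) M≤2)) ⟩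
    cnt (LH.short (D ∸ 1))    ≡⟨ cong (λ d → cnt (LH.short (d ∸ 1))) D≡M ⟩
    cnt (LH.short (M ∸ 1))    ≡⟨ sym (leaves-short P M≥1) ⟩
    cnt (λ i → deg P i ≡ᵇ 1)  ∎

  leaves≤2 : cnt (λ v → deg Γ v ≡ᵇ 1) ≤ 2
  leaves≤2 = subst (_≤ 2) (sym same-leaves) path-leaves≤2

  has-leaf : ∃ λ a → deg Γ a ≡ 1
  has-leaf = a , ≡ᵇ-sound {deg Γ a} {1} (proj₂ witness)
    where
    witness : ∃ λ a → (deg Γ a ≡ᵇ 1) ≡ true
    witness = cnt-witness (λ v → deg Γ v ≡ᵇ 1)
      (subst (1 ≤_) (sym same-leaves) (cnt-pos (λ i → deg P i ≡ᵇ 1) (≡ᵇ-true {deg P first} {1} first-leaf)))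
    a : Fin n
    a = proj₁ witness

  k≤1 : (S : G.Sub) → connectedᵇ Γ S ≡ true → kIndex Γ S ℤ.≤ + 1
  k≤1 S c = +-cancelˡ-≤ (+ n) _ _ (subst (λ m → LG.exponent S ℤ.≤ + m ℤ.+ + 1) (sym n≡t) (exponent≤t+1 S c))

-- Walk
-- from a, always leaving by the edge not used to arrive; the walk is an
-- induced path and must stop at a second leaf; the vertices it visits are
-- closed under adjacency, and any vertex it misses would lie in a
-- component of degree-2 vertices, which has index 2.
module Recognition (Γ : Graph)
  (deg≥1 : ∀ v → 1 ≤ deg Γ v)
  (deg≤2 : ∀ v → deg Γ v ≤ 2)
  (leaves≤2 : Counting.cnt (λ v → deg Γ v ≡ᵇ 1) ≤ 2)
  (a : Fin (order Γ)) (leaf-a : deg Γ a ≡ 1)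
  (k≤1 : ∀ S → connectedᵇ Γ S ≡ true → kIndex Γ S ℤ.≤ + 1)
  where

  open GraphFacts Γ
  open Counting

  next : Fin n → Fin n → Fin n
  next p c with any? (λ u → (A c u ≟ᵇ true) ×-dec ¬? (u ≟ᶠ p))
  ... | yes (u , _) = u
  ... | no _ = c

  next-spec : (p c : Fin n) → (∃ λ u → A c u ≡ true × u ≢ p) → A c (next p c) ≡ true × next p c ≢ p
  next-spec p c found with any? (λ u → (A c u ≟ᵇ true) ×-dec ¬? (u ≟ᶠ p))
  ... | yes (_ , spec) = spec
  ... | no none = ⊥-elim (none found)

  w : ℕ → Fin n
  w zero = a
  w (suc zero) = next a a
  w (suc (suc i)) = next (w i) (w (suc i))

  prev : ℕ → Fin n
  prev zero = a
  prev (suc i) = w i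

  w-suc : ∀ i → w (suc i) ≡ next (prev i) (w i)
  w-suc zero = refl
  w-suc (suc i) = refl

  record Prefix (J : ℕ) : Set where
    field
      consecutive : ∀ {i} → i < J → A (w i) (w (suc i)) ≡ true
      distinct    : ∀ {i k} → i ≤ J → k ≤ J → w i ≡ w k → i ≡ k
      inner       : ∀ {i} → 1 ≤ i → i < J → deg Γ (w i) ≡ 2
  open Prefix

  prefix₀ : Prefix 0
  prefix₀ = record { consecutive = λ () ; distinct = λ { z≤n z≤n _ → refl } ; inner = λ _ () }

  neighbour-of-a : ∀ {J} → Prefix J → 1 ≤ J → ∀ {u} → A a u ≡ true → u ≡ w 1
  neighbour-of-a pre 1≤J au = at-most-one (A a) (ℕ.≤-reflexive leaf-a) au (consecutive pre 1≤J)

  neighbour-of-inner : ∀ {J} → Prefix J → ∀ {i} → suc i < J → ∀ {u} → A (w (suc i)) u ≡ true → u ≡ w i ⊎ u ≡ w (suc (suc i))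
  neighbour-of-inner pre {i} i+1<J au = at-most-two (A (w (suc i))) (deg≤2 _) apart
    (adj-sym (consecutive pre (ℕ.<⇒≤ i+1<J))) (consecutive pre i+1<J) au
    where
    apart : w i ≢ w (suc (suc i))
    apart e with distinct pre (ℕ.≤-trans (ℕ.n≤1+n _) (ℕ.≤-trans (ℕ.n≤1+n _) i+1<J)) i+1<J e
    ... | ()

  no-chord : ∀ {J} → Prefix J → ∀ {i k} → suc (suc i) ≤ k → k ≤ J → A (w i) (w k) ≡ false
  no-chord {J} pre {i} {k} i+2≤k k≤J with A (w i) (w k) in chord
  ... | false = refl
  ... | true = ⊥-elim (chord-impossible i i+2≤k chord)
    where
    below : ∀ {j} → j ≤ k → j ≤ J
    below j≤k = ℕ.≤-trans j≤k k≤J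
    far : ∀ i → suc (suc (suc i)) ≤ k → i < k
    far i i+3≤k = ℕ.≤-trans (ℕ.n≤1+n _) (ℕ.≤-trans (ℕ.n≤1+n _) i+3≤k)
    -- w k would be a walk-neighbour of w i, so k would be i - 1 or i + 1.
    chord-impossible : ∀ i → suc (suc i) ≤ k → A (w i) (w k) ≡ true → ⊥
    chord-impossible zero 2≤k ch =
      ℕ.<⇒≢ 2≤k (sym (distinct pre k≤J (below (ℕ.<⇒≤ 2≤k)) (neighbour-of-a pre (below (ℕ.<⇒≤ 2≤k)) ch)))
    chord-impossible (suc i) i+3≤k ch with neighbour-of-inner pre (below (ℕ.<⇒≤ i+3≤k)) ch
    ... | inj₁ e = ℕ.<⇒≢ (far i i+3≤k) (sym (distinct pre k≤J (below (ℕ.<⇒≤ (far i i+3≤k))) e))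
    ... | inj₂ e = ℕ.<⇒≢ i+3≤k (sym (distinct pre k≤J (below (ℕ.<⇒≤ i+3≤k)) e))

  can-continue : ∀ J → J ≡ 0 ⊎ deg Γ (w J) ≡ 2 → ∃ λ u → A (w J) u ≡ true × u ≢ prev J
  can-continue .zero (inj₁ refl) with cnt-witness (A a) (deg≥1 a)
  ... | u , au = u , au , λ u≡a → adj-irrefl au (sym u≡a)
  can-continue J (inj₂ deg-2) = another (A (w J)) (ℕ.≤-reflexive (sym deg-2)) (prev J)

  extend : ∀ J → Prefix J → J ≡ 0 ⊎ deg Γ (w J) ≡ 2 → Prefix (suc J)
  extend J pre continues = record { consecutive = consecutive′ ; distinct = distinct′ ; inner = inner′ }
    where
    step : A (w J) (w (suc J)) ≡ true × w (suc J) ≢ prev J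
    step = subst (λ x → A (w J) x ≡ true × x ≢ prev J) (sym (w-suc J)) (next-spec (prev J) (w J) (can-continue J continues))

    fresh : ∀ {k} → k ≤ J → w (suc J) ≢ w k
    fresh {k} k≤J e with ℕ.m≤n⇒m<n∨m≡n k≤J
    ... | inj₂ refl = adj-irrefl (proj₁ step) (sym e)
    ... | inj₁ k<J with ℕ.m≤n⇒m<n∨m≡n k<J
    ...   | inj₂ refl = proj₂ step e
    ...   | inj₁ k+1<J = true≢false (trans (sym (adj-sym (subst (λ x → A (w J) x ≡ true) e (proj₁ step)))) (no-chord pre k+1<J ℕ.≤-refl))

    consecutive′ : ∀ {i} → i < suc J → A (w i) (w (suc i)) ≡ true
    consecutive′ (s≤s i≤J) with ℕ.m≤n⇒m<n∨m≡n i≤J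
    ... | inj₁ i<J = consecutive pre i<J
    ... | inj₂ refl = proj₁ step

    distinct′ : ∀ {i k} → i ≤ suc J → k ≤ suc J → w i ≡ w k → i ≡ k
    distinct′ i≤ k≤ e with ℕ.m≤n⇒m<n∨m≡n i≤ | ℕ.m≤n⇒m<n∨m≡n k≤
    ... | inj₁ (s≤s i≤J) | inj₁ (s≤s k≤J) = distinct pre i≤J k≤J e
    ... | inj₂ refl | inj₂ refl = refl
    ... | inj₂ refl | inj₁ (s≤s k≤J) = ⊥-elim (fresh k≤J e)
    ... | inj₁ (s≤s i≤J) | inj₂ refl = ⊥-elim (fresh i≤J (sym e))

    inner′ : ∀ {i} → 1 ≤ i → i < suc J → deg Γ (w i) ≡ 2
    inner′ 1≤i (s≤s i≤J) with ℕ.m≤n⇒m<n∨m≡n i≤J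
    ... | inj₁ i<J = inner pre 1≤i i<J
    ... | inj₂ refl = last continues 1≤i
      where
      last : J ≡ 0 ⊎ deg Γ (w J) ≡ 2 → 1 ≤ J → deg Γ (w J) ≡ 2
      last (inj₂ deg-2) _ = deg-2
      last (inj₁ refl) ()

  record Stop : Set where
    field
      m      : ℕ
      prefix : Prefix m
      1≤m    : 1 ≤ m
      leaf-m : deg Γ (w m) ≡ 1

  degree-1-or-2 : ∀ v → deg Γ v ≡ 1 ⊎ deg Γ v ≡ 2
  degree-1-or-2 v with deg Γ v | deg≥1 v | deg≤2 v
  ... | 1 | _ | _ = inj₁ refl
  ... | 2 | _ | _ = inj₂ refl
  ... | suc (suc (suc _)) | _ | s≤s (s≤s ())

  run : ∀ k → Stop ⊎ Prefix k
  run zero = inj₂ prefix₀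
  run (suc zero) = inj₂ (extend 0 prefix₀ (inj₁ refl))
  run (suc (suc k)) with run (suc k)
  ... | inj₁ stop = inj₁ stop
  ... | inj₂ pre with degree-1-or-2 (w (suc k))
  ...   | inj₁ leaf = inj₁ (record { m = suc k ; prefix = pre ; 1≤m = s≤s z≤n ; leaf-m = leaf })
  ...   | inj₂ deg-2 = inj₂ (extend (suc k) pre (inj₂ deg-2))

  -- A prefix visits distinct vertices, so it has at most n steps.
  no-long-prefix : Prefix n → ⊥
  no-long-prefix pre = ℕ.<-irrefl refl (injective⇒≤ {f = λ (i : Fin (suc n)) → w (toℕ i)}
    λ e → toℕ-injective (distinct pre (ℕ.≤-pred (toℕ<n _)) (ℕ.≤-pred (toℕ<n _)) e))

  stop : Stop
  stop with run n
  ... | inj₁ s = s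
  ... | inj₂ pre = ⊥-elim (no-long-prefix pre)
  open Stop stop

  a≢w-m : a ≢ w m
  a≢w-m e = ℕ.<⇒≢ 1≤m (distinct prefix z≤n ℕ.≤-refl e)

  walk-closed : ∀ {i} → i ≤ m → ∀ {u} → A (w i) u ≡ true → ∃ λ k → k ≤ m × w k ≡ u
  walk-closed {zero} _ au = 1 , 1≤m , sym (neighbour-of-a prefix 1≤m au)
  walk-closed {suc i} i+1≤m au with ℕ.m≤n⇒m<n∨m≡n i+1≤m
  ... | inj₁ i+1<m with neighbour-of-inner prefix i+1<m au
  ...   | inj₁ e = i , ℕ.≤-trans (ℕ.n≤1+n i) i+1≤m , sym e
  ...   | inj₂ e = suc (suc i) , i+1<m , sym e
  walk-closed {suc i} i+1≤m au | inj₂ i+1≡m =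
    i , ℕ.≤-trans (ℕ.n≤1+n i) i+1≤m ,
    sym (at-most-one (A (w (suc i))) (ℕ.≤-reflexive (subst (λ j → deg Γ (w j) ≡ 1) (sym i+1≡m) leaf-m))
                     au (adj-sym (consecutive prefix i+1≤m)))

  OnWalk : Fin n → Set
  OnWalk u = ∃ λ (k : Fin (suc m)) → w (toℕ k) ≡ u

  on-walk : ∀ {k} → k ≤ m → OnWalk (w k)
  on-walk k≤m = fromℕ< (s≤s k≤m) , cong w (toℕ-fromℕ< (s≤s k≤m))

  -- Off the walk: adjacency-closed, and only vertices of degree 2 (both
  -- leaves a and w m are on the walk).
  off-walk-closed : ∀ {x y} → ¬ OnWalk x → A x y ≡ true → ¬ OnWalk y
  off-walk-closed {x} x-off a (k , wk≡y) with walk-closed (ℕ.≤-pred (toℕ<n k)) (adj-sym (subst (λ z → A x z ≡ true) (sym wk≡y) a))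
  ... | j , j≤m , wj≡x = x-off (subst OnWalk wj≡x (on-walk j≤m))

  off-walk-degree-2 : ∀ {x} → ¬ OnWalk x → deg Γ x ≡ 2
  off-walk-degree-2 {x} x-off with degree-1-or-2 x
  ... | inj₂ deg-2 = deg-2
  ... | inj₁ leaf with at-most-two (λ v → deg Γ v ≡ᵇ 1) leaves≤2 a≢w-m (≡ᵇ-true leaf-a) (≡ᵇ-true leaf-m) (≡ᵇ-true leaf)
  ...   | inj₁ x≡a = ⊥-elim (x-off (subst OnWalk (sym x≡a) (on-walk z≤n)))
  ...   | inj₂ x≡w-m = ⊥-elim (x-off (subst OnWalk (sym x≡w-m) (on-walk ℕ.≤-refl)))

  -- Every vertex is visited: otherwise its component avoids the walk, so
  -- consists of degree-2 vertices and has index 2 > 1.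
  covered : ∀ u → ∃ λ k → k ≤ m × w k ≡ u
  covered u with any? (λ (k : Fin (suc m)) → w (toℕ k) ≟ᶠ u)
  ... | yes (k , e) = toℕ k , ℕ.≤-pred (toℕ<n k) , e
  ... | no missed = ⊥-elim (ℕ.<-irrefl refl (ℤ.drop‿+≤+ (ℤ.≤-trans 2≤k (k≤1 K connected))))
    where
    open Components.Component (Components.component Γ u (λ x → ¬ OnWalk x) off-walk-closed missed)
    2≤k : + 2 ℤ.≤ kIndex Γ K
    2≤k = Components.closed-k Γ K closed 2 (subst (_≤ D) (off-walk-degree-2 missed) (deg≤D u))
            (λ xK → ℕ.≤-reflexive (sym (off-walk-degree-2 (inherits xK))))

  walk-adjacency : ∀ {i k} → i ≤ m → k ≤ m → A (w i) (w k) ≡ (suc i ≡ᵇ k) ∨ (suc k ≡ᵇ i)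
  walk-adjacency {i} {k} i≤m k≤m with suc i ℕ.≟ k | suc k ℕ.≟ i
  ... | yes refl | _ rewrite ≡ᵇ-true {suc i} refl = consecutive prefix k≤m
  ... | no _ | yes refl rewrite ≡ᵇ-true {suc k} refl | ∨-zeroʳ (suc (suc k) ≡ᵇ k) = adj-sym (consecutive prefix i≤m)
  ... | no i+1≢k | no k+1≢i rewrite ≡ᵇ-false i+1≢k | ≡ᵇ-false k+1≢i with ℕ.<-cmp i k
  ...   | tri≈ _ refl _ = irrefl Γ (w i)
  ...   | tri< i<k _ _ = no-chord prefix (ℕ.≤∧≢⇒< i<k i+1≢k) k≤m
  ...   | tri> _ _ k<i = trans (Graph.sym Γ (w i) (w k)) (no-chord prefix (ℕ.≤∧≢⇒< k<i k+1≢i) i≤m)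

  position : Fin n → ℕ
  position u = proj₁ (covered u)

  position≤m : ∀ u → position u ≤ m
  position≤m u = proj₁ (proj₂ (covered u))

  w-position : ∀ u → w (position u) ≡ u
  w-position u = proj₂ (proj₂ (covered u))

  order≡ : suc m ≡ n
  order≡ = ℕ.≤-antisym (injective⇒≤ {f = λ (i : Fin (suc m)) → w (toℕ i)} visit-injective)
                       (injective⇒≤ {f = λ u → fromℕ< (s≤s (position≤m u))} position-injective)
    where
    visit-injective : ∀ {i j : Fin (suc m)} → w (toℕ i) ≡ w (toℕ j) → i ≡ j
    visit-injective e = toℕ-injective (distinct prefix (ℕ.≤-pred (toℕ<n _)) (ℕ.≤-pred (toℕ<n _)) e)
    position-injective : ∀ {u v} → fromℕ< (s≤s (position≤m u)) ≡ fromℕ< (s≤s (position≤m v)) → u ≡ v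
    position-injective {u} {v} e = begin
      u                 ≡⟨ sym (w-position u) ⟩
      w (position u)    ≡⟨ cong w (trans (sym (toℕ-fromℕ< _)) (trans (cong toℕ e) (toℕ-fromℕ< _))) ⟩
      w (position v)    ≡⟨ w-position v ⟩
      v                 ∎
      where open ≡-Reasoning

  isomorphic : (t : ℕ) (p : 1 ≤ t) → n ≡ t → Γ ≅ pathGraph t p
  isomorphic t p n≡t = record { bij = mk↔ₛ′ to from to∘from from∘to ; preserve = preserve }
    where
    position<t : ∀ u → position u < t
    position<t u = ℕ.≤-trans (s≤s (position≤m u)) (ℕ.≤-reflexive (trans order≡ n≡t))
    to : Fin n → Fin t
    to u = fromℕ< (position<t u)
    from : Fin t → Fin n
    from i = w (toℕ i)
    toℕ-to : ∀ u → toℕ (to u) ≡ position u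
    toℕ-to u = toℕ-fromℕ< (position<t u)
    index≤m : ∀ (i : Fin t) → toℕ i ≤ m
    index≤m i = ℕ.≤-pred (ℕ.≤-trans (toℕ<n i) (ℕ.≤-reflexive (sym (trans order≡ n≡t))))
    to∘from : ∀ i → to (from i) ≡ i
    to∘from i = toℕ-injective (trans (toℕ-to (from i)) (distinct prefix (position≤m (from i)) (index≤m i) (w-position (from i))))
    from∘to : ∀ u → from (to u) ≡ u
    from∘to u = trans (cong w (toℕ-to u)) (w-position u)
    preserve : ∀ u v → adj Γ u v ≡ pathAdj t (to u) (to v)
    preserve u v = begin
      A u v                                                        ≡⟨ sym (cong₂ A (w-position u) (w-position v)) ⟩
      A (w (position u)) (w (position v))                          ≡⟨ walk-adjacency (position≤m u) (position≤m v) ⟩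
      (suc (position u) ≡ᵇ position v) ∨ (suc (position v) ≡ᵇ position u)
                                                                   ≡⟨ sym (cong₂ (λ x y → (suc x ≡ᵇ y) ∨ (suc y ≡ᵇ x)) (toℕ-to u) (toℕ-to v)) ⟩
      pathAdj t (to u) (to v)                                      ∎
      where open ≡-Reasoning

theorem3p3 : (t : ℕ) → (2≤t : 2 ≤ t) → (Γ : Graph)
    → SameAlliancePoly Γ (pathGraph t (≤-trans (n≤1+n 1) 2≤t))
    → Γ ≅ pathGraph t (≤-trans (n≤1+n 1) 2≤t)
theorem3p3 t 2≤t Γ same =
  Recognition.isomorphic Γ deg≥1 deg≤2 leaves≤2 (proj₁ has-leaf) (proj₂ has-leaf) k≤1 t (≤-trans (n≤1+n 1) 2≤t) n≡t
  where open LikeAPath t 2≤t Γ same
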